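{- Let $k\ge 1$ and let $G$ be a graph obtained from the base graph $B_1$ by $k-1$ applications of Operation $\mathcal{O}_1$, via a sequence $B_1, B_2,\dots,B_k = G$ in which $B_{j+1}$ is obtained from $B_j$ by one application of $\mathcal{O}_1$. Then: (a) $i(G) = 2k+1$, $\mathrm{w}(G) = 16k+6$, and $8i(G) = \mathrm{w}(G) + 2$; (b) the canonical ID-set of $G$ is a minimum independent dominating set of $G$; (c) the non-canonical independent set of $G$ together with the root of $G$ is a minimum independent dominating set of $G$; (d) if $v$ is the root of $G$ or a vertex of degree $2$ in $G$, then $i(G - v) = i(G) - 1$; (e) the core independent set of $G$ is an independent dominating set of the graph obtained from $G$ by removing all vertices of degree $2$ in $G$; (f) $G$ contains at most one vertex of degree $1$, and no two adjacent vertices of $G$ both have degree $2$ in $G$.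
   Context: $i(H)$ is the independent domination number (minimum size of an independent set dominating all other vertices). For a subcubic graph $H$, $\mathrm{w}(H) = 8n_0(H)+5n_1(H)+4n_2(H)+3n_3(H)$ where $n_j(H)$ is the number of vertices of degree $j$. $B_1$ is the graph obtained from $K_{2,3}$ by adding a new vertex $r$ and an edge joining $r$ to a vertex of degree $2$ of the $K_{2,3}$. Operation $\mathcal{O}_1$: from a graph $G'$, select a vertex $v'$ of degree at most $2$ in $G'$, add a vertex-disjoint copy of $K_{2,3}$, and add an edge joining $v'$ to a vertex of degree $2$ in the added copy. The root of $G$ is the unique vertex of $G$ lying on no cycle (the vertex $r$). Canonical ID-set (with respect to the given sequence): for $B_1$ it consists of $r$ and the two vertices of degree $2$ in $B_1$; when $B_{j+1}$ is obtained from $B_j$ by $\mathcal{O}_1$, the canonical ID-set of $B_{j+1}$ is that of $B_j$ together with the two vertices of the newly added copy of $K_{2,3}$ that have degree $2$ in $B_{j+1}$. Each copy of $K_{2,3}$ in $G$ contains exactly two canonical vertices; their two common neighbors in that copy (the two vertices of degree $3$ of the copy of $K_{2,3}$) are called non-canonical vertices, and the non-canonical independent set is the set of all $2k$ non-canonical vertices. The core independent set is the set of vertices of $G$ belonging to neither the canonical ID-set nor the non-canonical independent set (it contains exactly one vertex from each of the $k$ copies of $K_{2,3}$). -}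

module Defs where

open import Data.Nat using (ℕ; zero; suc; _+_; _*_; _∸_; _≤_; _<_; _≡ᵇ_; _%_)
open import Data.Bool using (Bool; true; false; _∧_; _∨_; not; if_then_else_)
open import Data.Fin using (Fin; toℕ; fromℕ<)
import Data.Fin
open import Data.Fin.Subset using (Subset; _∈_; _∉_; _⊆_; ∣_∣; ⊤; ⁅_⁆; _∪_; _─_)
open import Data.Vec using (tabulate; sum)
open import Data.List using (List; []; _∷_; _++_)
open import Data.Bool.ListAction using (any)
open import Data.Product using (Σ; _×_; _,_)
open import Relation.Binary.PropositionalEquality using (_≡_)

record Graph : Set where
  field
    n   : ℕ
    adj : Fin n → Fin n → Bool
open Graph public

nbhd : (G : Graph) → Fin (n G) → Subset (n G)
nbhd G v = tabulate (adj G v)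

deg : (G : Graph) → Fin (n G) → ℕ
deg G v = ∣ nbhd G v ∣

-- Independent dominating sets of an induced subgraph G[S]
-- (S = vertex set of the graph under consideration; G - v is G[⊤ ─ ⁅ v ⁆])

Independent : (G : Graph) → Subset (n G) → Set
Independent G D = ∀ u v → u ∈ D → v ∈ D → adj G u v ≡ false

IsIDS : (G : Graph) → (S D : Subset (n G)) → Set
IsIDS G S D =
  D ⊆ S × Independent G D ×
  (∀ v → v ∈ S → v ∉ D → Σ (Fin (n G)) λ u → u ∈ D × adj G u v ≡ true)

IsMinIDS : (G : Graph) → (S D : Subset (n G)) → Set
IsMinIDS G S D = IsIDS G S D × (∀ D′ → IsIDS G S D′ → ∣ D ∣ ≤ ∣ D′ ∣)

IsIndDomNum : (G : Graph) → Subset (n G) → ℕ → Set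
IsIndDomNum G S m = Σ (Subset (n G)) λ D → IsMinIDS G S D × ∣ D ∣ ≡ m

-- weight w(H) = 8 n0 + 5 n1 + 4 n2 + 3 n3  (for subcubic graphs;
-- degrees ≥ 4 never occur in the graphs considered and get weight 0)

wdeg : ℕ → ℕ
wdeg 0 = 8
wdeg 1 = 5
wdeg 2 = 4
wdeg 3 = 3
wdeg _ = 0

weight : Graph → ℕ
weight G = sum (tabulate (λ v → wdeg (deg G v)))

-- Vertex labelling convention:
--   0                 : the root r
--   copy j (j = 0,1,..) of K_{2,3} occupies 1+5j .. 5+5j:
--     aV j = 1+5j , bV j = 2+5j   : the two vertices of degree 3 in K_{2,3}
--     cV j = 3+5j                 : degree-2 vertex of K_{2,3} used for the attaching edge
--     dV j = 4+5j , eV j = 5+5j   : the other two degree-2 vertices of K_{2,3}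
-- Copy j is attached to vertex p j (p 0 = 0 = r gives B_1).

aV bV cV dV eV : ℕ → ℕ
aV j = 1 + 5 * j
bV j = 2 + 5 * j
cV j = 3 + 5 * j
dV j = 4 + 5 * j
eV j = 5 + 5 * j

k23 : ℕ → List (ℕ × ℕ)
k23 j = (aV j , cV j) ∷ (aV j , dV j) ∷ (aV j , eV j)
      ∷ (bV j , cV j) ∷ (bV j , dV j) ∷ (bV j , eV j) ∷ []

Edges : (ℕ → ℕ) → ℕ → List (ℕ × ℕ)
Edges p zero    = []
Edges p (suc j) = Edges p j ++ k23 j ++ ((p j , cV j) ∷ [])

adjE : List (ℕ × ℕ) → ℕ → ℕ → Bool
adjE es x y = any (λ { (a , b) → ((a ≡ᵇ x) ∧ (b ≡ᵇ y)) ∨ ((a ≡ᵇ y) ∧ (b ≡ᵇ x)) }) es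

-- B p j : for j ≥ 1 this is the graph B_j (5j+1 vertices)
B : (ℕ → ℕ) → ℕ → Graph
B p j = record { n = suc (5 * j) ; adj = λ u v → adjE (Edges p j) (toℕ u) (toℕ v) }

-- p encodes a legal sequence B_1, ..., B_k: copy 0 is attached to r, and for
-- 1 ≤ j < k copy j is attached to a vertex p j of B_j of degree ≤ 2 in B_j.
ValidSeq : (ℕ → ℕ) → ℕ → Set
ValidSeq p k =
  p 0 ≡ 0 ×
  (∀ j → 1 ≤ j → j < k →
     Σ (p j < suc (5 * j)) λ h → deg (B p j) (fromℕ< h) ≤ 2)

-- Distinguished vertex sets (vertex x, in copy (x-1)/5 with role (x-1)%5)

role : ℕ → ℕ
role x = (x ∸ 1) % 5

isRoot isCanon isNonCanon isCore : ℕ → Bool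
isRoot x = x ≡ᵇ 0
isCanon x = isRoot x ∨ (not (isRoot x) ∧ ((role x ≡ᵇ 3) ∨ (role x ≡ᵇ 4)))
isNonCanon x = not (isRoot x) ∧ ((role x ≡ᵇ 0) ∨ (role x ≡ᵇ 1))
isCore x = not (isRoot x) ∧ (role x ≡ᵇ 2)

toSet : (m : ℕ) → (ℕ → Bool) → Subset m
toSet m f = tabulate (λ v → f (toℕ v))

canonicalSet nonCanonicalSet coreSet : (p : ℕ → ℕ) → (k : ℕ) → Subset (n (B p k))
canonicalSet p k = toSet (n (B p k)) isCanon
nonCanonicalSet p k = toSet (n (B p k)) isNonCanon
coreSet p k = toSet (n (B p k)) isCore

root : (p : ℕ → ℕ) → (k : ℕ) → Fin (n (B p k))
root p k = Data.Fin.zero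

notDeg2 : (G : Graph) → Subset (n G)
notDeg2 G = tabulate (λ v → not (deg G v ≡ᵇ 2))

deg1Set : (G : Graph) → Subset (n G)
deg1Set G = tabulate (λ v → deg G v ≡ᵇ 1)

-- Let S be a vertex set containing every non-canonical vertex and D an independent dominating
-- set of G[S]. The five vertices of the last copy of K_{2,3} contain at least
-- [c ∈ D] + [d ∈ S] + [e ∈ S] vertices of D, and D restricted to the earlier copies, enlarged by
-- the attachment vertex when c is its only dominator, is independent dominating there. By
-- induction |D| is at least the number of canonical vertices in S: 2k + 1 for G, and 2k for
-- G - v when v is canonical, which the root and every vertex of degree 2 are. The canonical,
-- non-canonical and core sets attain these bounds. Every vertex has its degree inside its own
-- copy plus the number of copies attached to it, which yields the weight and part (f).

module Submission where

open import Defs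
open import Data.Bool using (Bool; true; false; T; not; _∧_; _∨_; if_then_else_)
open import Data.Bool.Properties using (T?; T-≡; T-∧; T-∨; ∨-comm; ∨-identityʳ; ∧-zeroʳ; ∧-identityʳ)
open import Data.Empty using (⊥; ⊥-elim)
open import Data.Fin using (Fin; toℕ; fromℕ<) renaming (zero to fzero; suc to fsuc)
open import Data.Fin.Properties using (toℕ<n; toℕ-fromℕ<)
open import Data.Fin.Subset using (Subset; _∈_; _∉_; ∣_∣; ⊤; ⁅_⁆; _∪_; _─_)
open import Data.List using (List; []; _∷_; _++_)
open import Data.List.Membership.Propositional using () renaming (_∈_ to _∈ₗ_)
open import Data.List.Membership.Propositional.Properties using (∈-++⁻; ∈-++⁺ˡ; ∈-++⁺ʳ)
open import Data.List.Relation.Unary.Any using (here; there)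
open import Data.Nat using (ℕ; zero; suc; _+_; _*_; _∸_; _≤_; _<_; _≰_; _<?_; z≤n; s≤s; _≡ᵇ_; _<ᵇ_; _≤ᵇ_; _%_)
open import Data.Nat.DivMod using ([m+kn]%n≡m%n; m<n⇒m%n≡m)
open import Data.Nat.Properties
open import Data.Product using (Σ; ∃-syntax; _×_; _,_; proj₁; proj₂)
open import Data.Sum using (_⊎_; inj₁; inj₂)
import Data.Sum as Sum
open import Data.Vec using ([]; _∷_; lookup; tabulate; replicate; sum)
open import Data.Vec.Properties using ([]=⇒lookup; lookup⇒[]=)
open import Function using (_∘_; _⇔_; Equivalence; mk⇔)
open import Relation.Binary.PropositionalEquality
open import Relation.Nullary using (¬_; yes; no)
open import Data.Nat.Tactic.RingSolver using (solve-∀)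

open Equivalence using (to; from)

⟦_⟧ : Bool → ℕ
⟦ true ⟧ = 1
⟦ false ⟧ = 0

∑< : ℕ → (ℕ → ℕ) → ℕ
∑< zero f = 0
∑< (suc n) f = ∑< n f + f n

count : ℕ → (ℕ → Bool) → ℕ
count n g = ∑< n (λ x → ⟦ g x ⟧)

≡ᵇ-refl : ∀ m → (m ≡ᵇ m) ≡ true
≡ᵇ-refl m = to T-≡ (≡⇒≡ᵇ m m refl)

≢⇒≡ᵇ-false : ∀ {m n} → m ≢ n → (m ≡ᵇ n) ≡ false
≢⇒≡ᵇ-false {m} {n} m≢n with m ≡ᵇ n in eq
... | true = ⊥-elim (m≢n (≡ᵇ⇒≡ m n (from T-≡ eq)))
... | false = refl

≡ᵇ-sym : ∀ m n → (m ≡ᵇ n) ≡ (n ≡ᵇ m)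
≡ᵇ-sym zero zero = refl
≡ᵇ-sym zero (suc n) = refl
≡ᵇ-sym (suc m) zero = refl
≡ᵇ-sym (suc m) (suc n) = ≡ᵇ-sym m n

¬T⇒≡false : ∀ {b} → ¬ T b → b ≡ false
¬T⇒≡false {false} _ = refl
¬T⇒≡false {true} ¬t = ⊥-elim (¬t _)

T-injective : ∀ {a b} → (T a → T b) → (T b → T a) → a ≡ b
T-injective {false} {false} _ _ = refl
T-injective {false} {true} _ b⇒a = ⊥-elim (b⇒a _)
T-injective {true} {false} a⇒b _ = ⊥-elim (a⇒b _)
T-injective {true} {true} _ _ = refl

∑<-cong : ∀ n {f g : ℕ → ℕ} → (∀ {x} → x < n → f x ≡ g x) → ∑< n f ≡ ∑< n g
∑<-cong zero eq = refl
∑<-cong (suc n) eq = cong₂ _+_ (∑<-cong n (eq ∘ m<n⇒m<1+n)) (eq ≤-refl)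

∑<-+ : ∀ n (f g : ℕ → ℕ) → ∑< n (λ x → f x + g x) ≡ ∑< n f + ∑< n g
∑<-+ zero f g = refl
∑<-+ (suc n) f g = trans (cong (_+ (f n + g n)) (∑<-+ n f g)) (interchange (∑< n f) _ _ _)
  where
  interchange : ∀ a b c d → (a + b) + (c + d) ≡ (a + c) + (b + d)
  interchange = solve-∀

∑<-shift : ∀ n f → ∑< (suc n) f ≡ f 0 + ∑< n (f ∘ suc)
∑<-shift zero f = +-comm 0 (f 0)
∑<-shift (suc n) f = trans (cong (_+ f (suc n)) (∑<-shift n f)) (+-assoc (f 0) _ _)

count-none : ∀ n {g} → (∀ {x} → x < n → g x ≡ false) → count n g ≡ 0
count-none zero none = refl
count-none (suc n) none = cong₂ _+_ (count-none n (none ∘ m<n⇒m<1+n)) (cong ⟦_⟧ (none ≤-refl))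

⟦⟧-mono : ∀ {a b} → (T a → T b) → ⟦ a ⟧ ≤ ⟦ b ⟧
⟦⟧-mono {false} _ = z≤n
⟦⟧-mono {true} {true} _ = ≤-refl
⟦⟧-mono {true} {false} a⇒b = ⊥-elim (a⇒b _)

count-mono : ∀ n {g h} → (∀ {x} → x < n → T (g x) → T (h x)) → count n g ≤ count n h
count-mono zero _ = z≤n
count-mono (suc n) g⇒h = +-mono-≤ (count-mono n (g⇒h ∘ m<n⇒m<1+n)) (⟦⟧-mono (g⇒h ≤-refl))

count-point : ∀ {n x₀} → x₀ < n → count n (_≡ᵇ x₀) ≡ 1
count-point {suc n} {x₀} x₀<1+n with x₀ ≟ n
... | yes refl = cong₂ _+_ (count-none n (≢⇒≡ᵇ-false ∘ <⇒≢)) (cong ⟦_⟧ (≡ᵇ-refl n))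
... | no x₀≢n = cong₂ _+_ (count-point (≤∧≢⇒< (≤-pred x₀<1+n) x₀≢n)) (cong ⟦_⟧ (≢⇒≡ᵇ-false (x₀≢n ∘ sym)))

count-witness : ∀ n {g} → 1 ≤ count n g → ∃[ y ] y < n × T (g y)
count-witness (suc n) {g} pos with g n in eq
... | true = n , ≤-refl , from T-≡ eq
... | false with count-witness n (≤-trans pos (≤-reflexive (+-identityʳ _)))
...   | y , y<n , gy = y , m<n⇒m<1+n y<n , gy

witness-count : ∀ {n g y} → y < n → T (g y) → 1 ≤ count n g
witness-count {n} {g} {y} y<n gy =
  ≤-trans (≤-reflexive (sym (count-point y<n))) (count-mono n λ {x} _ x≡y → subst (T ∘ g) (sym (≡ᵇ⇒≡ x y x≡y)) gy)

count-∨-point : ∀ {n x₀} g → x₀ < n → g x₀ ≡ false → count n (λ y → g y ∨ (y ≡ᵇ x₀)) ≡ suc (count n g)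
count-∨-point {n} {x₀} g x₀<n gx₀ = begin
  count n (λ y → g y ∨ (y ≡ᵇ x₀))          ≡⟨ ∑<-cong n (λ {y} _ → split y) ⟩
  ∑< n (λ y → ⟦ g y ⟧ + ⟦ y ≡ᵇ x₀ ⟧)      ≡⟨ ∑<-+ n _ _ ⟩
  count n g + count n (_≡ᵇ x₀)            ≡⟨ cong (count n g +_) (count-point x₀<n) ⟩
  count n g + 1                           ≡⟨ +-comm _ 1 ⟩
  suc (count n g)                         ∎
  where
  open ≡-Reasoning
  split : ∀ y → ⟦ g y ∨ (y ≡ᵇ x₀) ⟧ ≡ ⟦ g y ⟧ + ⟦ y ≡ᵇ x₀ ⟧
  split y with y ≟ x₀
  ... | yes refl rewrite gx₀ | ≡ᵇ-refl y = refl
  ... | no y≢x₀ rewrite ≢⇒≡ᵇ-false y≢x₀ | ∨-identityʳ (g y) = sym (+-identityʳ _)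


count-∧-point : ∀ n b {x₀} → x₀ < n → count n (λ y → b ∧ (x₀ ≡ᵇ y)) ≡ ⟦ b ⟧
count-∧-point n true x₀<n = trans (∑<-cong n (λ {y} _ → cong ⟦_⟧ (≡ᵇ-sym _ y))) (count-point x₀<n)
count-∧-point n false _ = count-none n (λ _ → refl)

member : ∀ {n} → Subset n → ℕ → Bool
member [] _ = false
member (b ∷ s) zero = b
member (b ∷ s) (suc x) = member s x

member-toℕ : ∀ {n} (s : Subset n) u → member s (toℕ u) ≡ lookup s u
member-toℕ (b ∷ s) fzero = refl
member-toℕ (b ∷ s) (fsuc u) = member-toℕ s u

∈⇔member : ∀ {n} {s : Subset n} {u} → u ∈ s ⇔ T (member s (toℕ u))
∈⇔member {s = s} {u} = mk⇔
  (λ u∈s → from T-≡ (trans (member-toℕ s u) ([]=⇒lookup u∈s)))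
  (λ t → lookup⇒[]= u s (trans (sym (member-toℕ s u)) (to T-≡ t)))

member-tabulate : ∀ n (f : ℕ → Bool) {x} → x < n → member (tabulate {n = n} (λ u → f (toℕ u))) x ≡ f x
member-tabulate (suc n) f {zero} _ = refl
member-tabulate (suc n) f {suc x} x<n = member-tabulate n (f ∘ suc) (≤-pred x<n)

∣∣≡count : ∀ {n} (s : Subset n) → ∣ s ∣ ≡ count n (member s)
∣∣≡count [] = refl
∣∣≡count {suc n} (b ∷ s) = trans (head+tail b) (trans (cong (⟦ b ⟧ +_) (∣∣≡count s)) (sym (∑<-shift n _)))
  where
  head+tail : ∀ b → ∣ b ∷ s ∣ ≡ ⟦ b ⟧ + ∣ s ∣
  head+tail true = refl
  head+tail false = refl

∣tabulate∣ : ∀ n (f : ℕ → Bool) → ∣ tabulate {n = n} (λ u → f (toℕ u)) ∣ ≡ count n f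
∣tabulate∣ n f = trans (∣∣≡count (tabulate {n = n} (λ u → f (toℕ u)))) (∑<-cong n (cong ⟦_⟧ ∘ member-tabulate n f))

sum-tabulate : ∀ n (f : ℕ → ℕ) → sum (tabulate {n = n} (λ u → f (toℕ u))) ≡ ∑< n f
sum-tabulate zero f = refl
sum-tabulate (suc n) f = trans (cong (f 0 +_) (sum-tabulate n (f ∘ suc))) (sym (∑<-shift n f))

member-⊤ : ∀ {n x} → x < n → member (⊤ {n}) x ≡ true
member-⊤ {suc n} {zero} _ = refl
member-⊤ {suc n} {suc x} x<n = member-⊤ (≤-pred x<n)

member-∪ : ∀ {n} (s t : Subset n) x → member (s ∪ t) x ≡ member s x ∨ member t x
member-∪ [] [] x = refl
member-∪ (a ∷ s) (b ∷ t) zero = refl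
member-∪ (a ∷ s) (b ∷ t) (suc x) = member-∪ s t x

member-─ : ∀ {n} (s t : Subset n) x → member (s ─ t) x ≡ member s x ∧ not (member t x)
member-─ [] [] x = refl
member-─ (a ∷ s) (true ∷ t) zero = sym (∧-zeroʳ a)
member-─ (a ∷ s) (false ∷ t) zero = sym (∧-identityʳ a)
member-─ (a ∷ s) (b ∷ t) (suc x) = member-─ s t x

member-⁅⁆ : ∀ {n} (i : Fin n) x → member ⁅ i ⁆ x ≡ (x ≡ᵇ toℕ i)
member-⁅⁆ fzero zero = refl
member-⁅⁆ {suc n} fzero (suc x) = member-∅ n x
  where
  member-∅ : ∀ n x → member (replicate n false) x ≡ false
  member-∅ zero x = refl
  member-∅ (suc n) zero = refl
  member-∅ (suc n) (suc x) = member-∅ n x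
member-⁅⁆ (fsuc i) zero = refl
member-⁅⁆ (fsuc i) (suc x) = member-⁅⁆ i x

member-⊤─⁅⁆ : ∀ {n} (v : Fin n) {x} → x < n → member (⊤ ─ ⁅ v ⁆) x ≡ not (x ≡ᵇ toℕ v)
member-⊤─⁅⁆ v {x} x<n = trans (member-─ ⊤ ⁅ v ⁆ x) (cong₂ (λ a b → a ∧ not b) (member-⊤ x<n) (member-⁅⁆ v x))

≡ᵇ-pair : ∀ {a b x y} → T ((a ≡ᵇ x) ∧ (b ≡ᵇ y)) → (x , y) ≡ (a , b)
≡ᵇ-pair {a} {b} {x} {y} t with to T-∧ t
... | a≡x , b≡y = sym (cong₂ _,_ (≡ᵇ⇒≡ a x a≡x) (≡ᵇ⇒≡ b y b≡y))

adjE-sound : ∀ es {x y} → T (adjE es x y) → (x , y) ∈ₗ es ⊎ (y , x) ∈ₗ es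
adjE-sound ((a , b) ∷ es) t with to T-∨ t
... | inj₂ t′ = Sum.map there there (adjE-sound es t′)
... | inj₁ t′ with to T-∨ t′
...   | inj₁ xy = inj₁ (here (≡ᵇ-pair xy))
...   | inj₂ yx = inj₂ (here (≡ᵇ-pair yx))

adjE-complete : ∀ es {x y} → (x , y) ∈ₗ es → T (adjE es x y)
adjE-complete ((a , b) ∷ es) (here refl) =
  from T-∨ (inj₁ (from T-∨ (inj₁ (from T-∧ (≡⇒≡ᵇ a a refl , ≡⇒≡ᵇ b b refl)))))
adjE-complete (_ ∷ es) (there m) = from T-∨ (inj₂ (adjE-complete es m))

adjE-sym : ∀ es x y → adjE es x y ≡ adjE es y x
adjE-sym [] x y = refl
adjE-sym ((a , b) ∷ es) x y = cong₂ _∨_ (∨-comm ((a ≡ᵇ x) ∧ (b ≡ᵇ y)) _) (adjE-sym es x y)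

order : ℕ → ℕ
order k = suc (5 * k)

-- Definitionally vertex j 0 = aV j, ..., vertex j 4 = eV j.
vertex : ℕ → ℕ → ℕ
vertex j i = suc (i + 5 * j)

order-suc : ∀ k → order (suc k) ≡ 5 + order k
order-suc k = cong suc (*-suc 5 k)

0<5 : 0 < 5
0<5 = s≤s z≤n
1<5 : 1 < 5
1<5 = s≤s (s≤s z≤n)
2<5 : 2 < 5
2<5 = s≤s (s≤s (s≤s z≤n))
3<5 : 3 < 5
3<5 = s≤s (s≤s (s≤s (s≤s z≤n)))
4<5 : 4 < 5
4<5 = ≤-refl

order-mono : ∀ {j k} → j ≤ k → order j ≤ order k
order-mono j≤k = s≤s (*-monoʳ-≤ 5 j≤k)

<order-suc : ∀ {k x} → x < order k → x < order (suc k)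
<order-suc {k} x<N = <-≤-trans x<N (order-mono (n≤1+n k))

order≤vertex : ∀ k i → order k ≤ vertex k i
order≤vertex k i = s≤s (m≤n+m (5 * k) i)

vertex<order : ∀ {j k} i → j < k → i < 5 → vertex j i < order k
vertex<order {j} {k} i j<k i<5 = ≤-trans (s≤s (+-monoˡ-< (5 * j) i<5)) (≤-trans (≤-reflexive (sym (order-suc j))) (order-mono j<k))

vertex-injective : ∀ k {i i′} → vertex k i ≡ vertex k i′ → i ≡ i′
vertex-injective k eq = +-cancelʳ-≡ (5 * k) _ _ (suc-injective eq)

role-vertex : ∀ j {i} → i < 5 → role (vertex j i) ≡ i
role-vertex j {i} i<5 = trans (cong (λ m → (i + m) % 5) (*-comm 5 j)) (trans ([m+kn]%n≡m%n i j 5) (m<n⇒m%n≡m i<5))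

old-or-new : ∀ k {x} → x < order (suc k) → x < order k ⊎ ∃[ i ] i < 5 × x ≡ vertex k i
old-or-new k {x} x<order with x <? order k
... | yes x<N = inj₁ x<N
... | no x≮N = inj₂ (x ∸ order k , i<5 , sym (trans (cong suc (+-comm (x ∸ order k) (5 * k))) (m+[n∸m]≡n N≤x)))
  where
  N≤x : order k ≤ x
  N≤x = ≮⇒≥ x≮N
  i<5 : x ∸ order k < 5
  i<5 = +-cancelˡ-< (order k) _ _ (subst (_< order k + 5) (sym (m+[n∸m]≡n N≤x))
          (subst (x <_) (trans (order-suc k) (+-comm 5 (order k))) x<order))

data VertexView (k : ℕ) : ℕ → Set where
  atRoot : VertexView k 0
  inCopy : ∀ {j} i → j < k → i < 5 → VertexView k (vertex j i)

vertexView : ∀ k {x} → x < order k → VertexView k x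
vertexView zero {zero} _ = atRoot
vertexView zero {suc _} (s≤s ())
vertexView (suc k) x<order with old-or-new k x<order
... | inj₂ (i , i<5 , refl) = inCopy i ≤-refl i<5
... | inj₁ x<N with vertexView k x<N
...   | atRoot = atRoot
...   | inCopy i j<k i<5 = inCopy i (m<n⇒m<1+n j<k) i<5

isCanon-vertex : ∀ j {i} → i < 5 → isCanon (vertex j i) ≡ (i ≡ᵇ 3) ∨ (i ≡ᵇ 4)
isCanon-vertex j i<5 = cong (λ r → (r ≡ᵇ 3) ∨ (r ≡ᵇ 4)) (role-vertex j i<5)

isNonCanon-vertex : ∀ j {i} → i < 5 → isNonCanon (vertex j i) ≡ (i ≡ᵇ 0) ∨ (i ≡ᵇ 1)
isNonCanon-vertex j i<5 = cong (λ r → (r ≡ᵇ 0) ∨ (r ≡ᵇ 1)) (role-vertex j i<5)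

isCore-vertex : ∀ j {i} → i < 5 → isCore (vertex j i) ≡ (i ≡ᵇ 2)
isCore-vertex j i<5 = cong (_≡ᵇ 2) (role-vertex j i<5)

isCanon-hub-or-core : ∀ j {i} → i < 3 → isCanon (vertex j i) ≡ false
isCanon-hub-or-core j {0} _ = isCanon-vertex j 0<5
isCanon-hub-or-core j {1} _ = isCanon-vertex j 1<5
isCanon-hub-or-core j {2} _ = isCanon-vertex j 2<5
isCanon-hub-or-core j {suc (suc (suc _))} (s≤s (s≤s (s≤s ())))

isNonCanon-leaf : ∀ j {i} → 2 ≤ i → i < 5 → isNonCanon (vertex j i) ≡ false
isNonCanon-leaf j {0} () _
isNonCanon-leaf j {1} (s≤s ()) _
isNonCanon-leaf j {2} _ _ = isNonCanon-vertex j 2<5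
isNonCanon-leaf j {3} _ _ = isNonCanon-vertex j 3<5
isNonCanon-leaf j {4} _ _ = isNonCanon-vertex j 4<5
isNonCanon-leaf j {suc (suc (suc (suc (suc _))))} _ (s≤s (s≤s (s≤s (s≤s (s≤s ())))))

isCore-hub : ∀ j {i} → i < 2 → isCore (vertex j i) ≡ false
isCore-hub j {0} _ = isCore-vertex j 0<5
isCore-hub j {1} _ = isCore-vertex j 1<5
isCore-hub j {suc (suc _)} (s≤s (s≤s ()))

canonical⇒¬core : ∀ x → T (isCanon x) → ¬ T (isCore x)
canonical⇒¬core zero _ ()
canonical⇒¬core (suc y) canon core with to (T-∨ {role (suc y) ≡ᵇ 3} {role (suc y) ≡ᵇ 4}) canon
... | inj₁ r≡3 with trans (sym (≡ᵇ⇒≡ (role (suc y)) 3 r≡3)) (≡ᵇ⇒≡ (role (suc y)) 2 core)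
...   | ()
canonical⇒¬core (suc y) canon core | inj₂ r≡4 with trans (sym (≡ᵇ⇒≡ (role (suc y)) 4 r≡4)) (≡ᵇ⇒≡ (role (suc y)) 2 core)
...   | ()

∑<-order-suc : ∀ k {f g : ℕ → ℕ} (h : ℕ → ℕ) → (∀ {x} → x < order k → f x ≡ g x) →
               (∀ {i} → i < 5 → f (vertex k i) ≡ h i) → ∑< (order (suc k)) f ≡ ∑< (order k) g + ∑< 5 h
∑<-order-suc k {f} {g} h old new = begin
  ∑< (order (suc k)) f
    ≡⟨ cong (λ m → ∑< m f) (order-suc k) ⟩
  ∑< (order k) f + f (vertex k 0) + f (vertex k 1) + f (vertex k 2) + f (vertex k 3) + f (vertex k 4)
    ≡⟨ cong₂ _+_ (cong₂ _+_ (cong₂ _+_ (cong₂ _+_ (cong₂ _+_ (∑<-cong (order k) old)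
                                                          (new 0<5)) (new 1<5)) (new 2<5)) (new 3<5)) (new 4<5) ⟩
  ∑< (order k) g + h 0 + h 1 + h 2 + h 3 + h 4
    ≡⟨ reassoc (∑< (order k) g) (h 0) (h 1) (h 2) (h 3) (h 4) ⟩
  ∑< (order k) g + ∑< 5 h ∎
  where
  open ≡-Reasoning
  reassoc : ∀ a b c d e f → a + b + c + d + e + f ≡ a + (0 + b + c + d + e + f)
  reassoc = solve-∀

count-canonical : ∀ k → count (order k) isCanon ≡ 2 * k + 1
count-canonical zero = refl
count-canonical (suc k) = begin
  count (order (suc k)) isCanon
    ≡⟨ ∑<-order-suc k (λ i → ⟦ (i ≡ᵇ 3) ∨ (i ≡ᵇ 4) ⟧) (λ _ → refl) (cong ⟦_⟧ ∘ isCanon-vertex k) ⟩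
  count (order k) isCanon + 2 ≡⟨ cong (_+ 2) (count-canonical k) ⟩
  2 * k + 1 + 2               ≡⟨ arith k ⟩
  2 * suc k + 1               ∎
  where
  open ≡-Reasoning
  arith : ∀ k → 2 * k + 1 + 2 ≡ 2 * suc k + 1
  arith = solve-∀

count-nonCanonical : ∀ k → count (order k) isNonCanon ≡ 2 * k
count-nonCanonical zero = refl
count-nonCanonical (suc k) = begin
  count (order (suc k)) isNonCanon
    ≡⟨ ∑<-order-suc k (λ i → ⟦ (i ≡ᵇ 0) ∨ (i ≡ᵇ 1) ⟧) (λ _ → refl) (cong ⟦_⟧ ∘ isNonCanon-vertex k) ⟩
  count (order k) isNonCanon + 2 ≡⟨ cong (_+ 2) (count-nonCanonical k) ⟩
  2 * k + 2                      ≡⟨ arith k ⟩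
  2 * suc k                      ∎
  where
  open ≡-Reasoning
  arith : ∀ k → 2 * k + 2 ≡ 2 * suc k
  arith = solve-∀

count-canonical-except : ∀ k {v} → v < order k → T (isCanon v) →
                         count (order k) (λ x → isCanon x ∧ not (x ≡ᵇ v)) ≡ 2 * k
count-canonical-except k {v} v<N canon = +-cancelʳ-≡ 1 _ _ (begin
  count (order k) canonical-except + 1       ≡⟨ +-comm _ 1 ⟩
  suc (count (order k) canonical-except)    ≡⟨ count-∨-point canonical-except v<N v-excluded ⟨
  count (order k) (λ y → canonical-except y ∨ (y ≡ᵇ v)) ≡⟨ ∑<-cong (order k) (λ {y} _ → cong ⟦_⟧ (restore y)) ⟩
  count (order k) isCanon                  ≡⟨ count-canonical k ⟩
  2 * k + 1                                ∎)
  where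
  open ≡-Reasoning
  canonical-except : ℕ → Bool
  canonical-except x = isCanon x ∧ not (x ≡ᵇ v)
  v-excluded : canonical-except v ≡ false
  v-excluded rewrite ≡ᵇ-refl v = ∧-zeroʳ (isCanon v)
  restore : ∀ y → canonical-except y ∨ (y ≡ᵇ v) ≡ isCanon y
  restore y with y ≟ v
  ... | yes refl rewrite ≡ᵇ-refl y | to T-≡ canon = refl
  ... | no y≢v rewrite ≢⇒≡ᵇ-false y≢v = trans (∨-identityʳ _) (∧-identityʳ _)

⟦⟧≤1 : ∀ b → ⟦ b ⟧ ≤ 1
⟦⟧≤1 true = ≤-refl
⟦⟧≤1 false = z≤n

-- Hubs a, b and leaves c, d, e of a copy of K_{2,3}; sd and se say whether d and e are in the vertex set.
k23-count : ∀ {a b c d e sd se : Bool} →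
  (T a ⊎ T b → ¬ (T c ⊎ T d ⊎ T e)) →
  (¬ T a → T c ⊎ T d ⊎ T e) → (¬ T b → T c ⊎ T d ⊎ T e) →
  (T sd → ¬ T d → T a ⊎ T b) → (T se → ¬ T e → T a ⊎ T b) →
  ⟦ c ⟧ + ⟦ sd ⟧ + ⟦ se ⟧ ≤ ⟦ a ⟧ + ⟦ b ⟧ + ⟦ c ⟧ + ⟦ d ⟧ + ⟦ e ⟧
k23-count {true} {true} {true} excl _ _ _ _ = ⊥-elim (excl (inj₁ _) (inj₁ _))
k23-count {true} {true} {false} {sd = sd} {se} _ _ _ _ _ = ≤-trans (+-mono-≤ (⟦⟧≤1 sd) (⟦⟧≤1 se)) (s≤s (s≤s z≤n))
k23-count {true} {false} excl _ b-dominated _ _ = ⊥-elim (excl (inj₁ _) (b-dominated λ ()))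
k23-count {false} {true} excl a-dominated _ _ _ = ⊥-elim (excl (inj₂ _) (a-dominated λ ()))
k23-count {false} {false} {c} {d} {e} _ _ _ d-dominated e-dominated =
  +-mono-≤ (+-monoʳ-≤ ⟦ c ⟧ (⟦⟧-mono (present⇒chosen d-dominated))) (⟦⟧-mono (present⇒chosen e-dominated))
  where
  present⇒chosen : ∀ {s x} → (T s → ¬ T x → T false ⊎ T false) → T s → T x
  present⇒chosen {x = x} dominated s with T? x
  ... | yes t = t
  ... | no ¬t with dominated s ¬t
  ...   | inj₁ ()
  ...   | inj₂ ()

roleAdj : ℕ → ℕ → Bool
roleAdj i i′ = ((i <ᵇ 2) ∧ (2 ≤ᵇ i′)) ∨ ((2 ≤ᵇ i) ∧ (i′ <ᵇ 2))

module Family (p : ℕ → ℕ) where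

  copyEdges : ℕ → List (ℕ × ℕ)
  copyEdges j = k23 j ++ (p j , cV j) ∷ []

  data CopyEdge (j : ℕ) : ℕ → ℕ → Set where
    inner  : ∀ i i′ → i < 2 → 2 ≤ i′ → i′ < 5 → CopyEdge j (vertex j i) (vertex j i′)
    attach : CopyEdge j (p j) (vertex j 2)

  Edge : ℕ → ℕ → ℕ → Set
  Edge j x y = CopyEdge j x y ⊎ CopyEdge j y x

  copyEdges-sound : ∀ j {x y} → (x , y) ∈ₗ copyEdges j → CopyEdge j x y
  copyEdges-sound j (here refl) = inner 0 2 (s≤s z≤n) ≤-refl 2<5
  copyEdges-sound j (there (here refl)) = inner 0 3 (s≤s z≤n) (s≤s (s≤s z≤n)) 3<5
  copyEdges-sound j (there (there (here refl))) = inner 0 4 (s≤s z≤n) (s≤s (s≤s z≤n)) 4<5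
  copyEdges-sound j (there (there (there (here refl)))) = inner 1 2 ≤-refl ≤-refl 2<5
  copyEdges-sound j (there (there (there (there (here refl))))) = inner 1 3 ≤-refl (s≤s (s≤s z≤n)) 3<5
  copyEdges-sound j (there (there (there (there (there (here refl)))))) = inner 1 4 ≤-refl (s≤s (s≤s z≤n)) 4<5
  copyEdges-sound j (there (there (there (there (there (there (here refl))))))) = attach

  copyEdges-complete : ∀ j {x y} → CopyEdge j x y → (x , y) ∈ₗ copyEdges j
  copyEdges-complete j (inner 0 2 _ _ _) = here refl
  copyEdges-complete j (inner 0 3 _ _ _) = there (here refl)
  copyEdges-complete j (inner 0 4 _ _ _) = there (there (here refl))
  copyEdges-complete j (inner 1 2 _ _ _) = there (there (there (here refl)))
  copyEdges-complete j (inner 1 3 _ _ _) = there (there (there (there (here refl))))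
  copyEdges-complete j (inner 1 4 _ _ _) = there (there (there (there (there (here refl)))))
  copyEdges-complete j attach = there (there (there (there (there (there (here refl))))))
  copyEdges-complete j (inner (suc (suc _)) _ (s≤s (s≤s ())) _ _)
  copyEdges-complete j (inner _ 0 _ () _)
  copyEdges-complete j (inner _ 1 _ (s≤s ()) _)
  copyEdges-complete j (inner _ (suc (suc (suc (suc (suc _))))) _ _ (s≤s (s≤s (s≤s (s≤s (s≤s ()))))))

  ∈Edges⁻ : ∀ k {e} → e ∈ₗ Edges p k → ∃[ j ] j < k × e ∈ₗ copyEdges j
  ∈Edges⁻ (suc k) e∈ with ∈-++⁻ (Edges p k) e∈
  ... | inj₂ e∈new = k , ≤-refl , e∈new
  ... | inj₁ e∈old with ∈Edges⁻ k e∈old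
  ...   | j , j<k , e∈j = j , m<n⇒m<1+n j<k , e∈j

  ∈Edges⁺ : ∀ {j k e} → j < k → e ∈ₗ copyEdges j → e ∈ₗ Edges p k
  ∈Edges⁺ {j} {suc k} j<1+k e∈j with j ≟ k
  ... | yes refl = ∈-++⁺ʳ (Edges p k) e∈j
  ... | no j≢k = ∈-++⁺ˡ (∈Edges⁺ (≤∧≢⇒< (≤-pred j<1+k) j≢k) e∈j)

  adjB : ℕ → ℕ → ℕ → Bool
  adjB k = adjE (Edges p k)

  adjB-sym : ∀ k x y → adjB k x y ≡ adjB k y x
  adjB-sym k = adjE-sym (Edges p k)

  adjB-sound : ∀ k {x y} → T (adjB k x y) → ∃[ j ] j < k × Edge j x y
  adjB-sound k t with adjE-sound (Edges p k) t
  ... | inj₁ xy∈ = let j , j<k , m = ∈Edges⁻ k xy∈ in j , j<k , inj₁ (copyEdges-sound j m)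
  ... | inj₂ yx∈ = let j , j<k , m = ∈Edges⁻ k yx∈ in j , j<k , inj₂ (copyEdges-sound j m)

  adjB-complete : ∀ {j k x y} → j < k → Edge j x y → T (adjB k x y)
  adjB-complete {j} {k} j<k (inj₁ e) = adjE-complete (Edges p k) (∈Edges⁺ j<k (copyEdges-complete j e))
  adjB-complete {j} {k} {x} {y} j<k (inj₂ e) =
    subst T (adjB-sym k y x) (adjE-complete (Edges p k) (∈Edges⁺ j<k (copyEdges-complete j e)))

  Attached : ℕ → Set
  Attached k = ∀ {j} → j < k → p j < order j

  Attached-≤ : ∀ {j k} → j ≤ k → Attached k → Attached j
  Attached-≤ j≤k att i<j = att (<-≤-trans i<j j≤k)

  Attached-pred : ∀ {k} → Attached (suc k) → Attached k
  Attached-pred = Attached-≤ (n≤1+n _)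

  copyEdge-bounded : ∀ {j x y} → p j < order j → CopyEdge j x y → x < order (suc j) × y < order (suc j)
  copyEdge-bounded _ (inner i i′ i<2 _ i′<5) = vertex<order i ≤-refl (<-trans i<2 2<5) , vertex<order i′ ≤-refl i′<5
  copyEdge-bounded {j} pj<N attach = <-≤-trans pj<N (order-mono (n≤1+n j)) , vertex<order 2 ≤-refl 2<5

  copyEdge-target-new : ∀ {j x y} → CopyEdge j x y → order j ≤ y
  copyEdge-target-new {j} (inner _ i′ _ _ _) = order≤vertex j i′
  copyEdge-target-new {j} attach = order≤vertex j 2

  copyEdge-source : ∀ {j x y} → CopyEdge j x y → order j ≤ x ⊎ (x ≡ p j × y ≡ vertex j 2)
  copyEdge-source {j} (inner i _ _ _ _) = inj₁ (order≤vertex j i)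
  copyEdge-source attach = inj₂ (refl , refl)

  copyEdge-irreflexive : ∀ {j x y} → p j < order j → CopyEdge j x y → x ≢ y
  copyEdge-irreflexive {j} _ (inner i i′ i<2 2≤i′ _) eq = <⇒≢ (<-≤-trans i<2 2≤i′) (vertex-injective j eq)
  copyEdge-irreflexive {j} pj<N attach eq = <⇒≢ (<-≤-trans pj<N (order≤vertex j 2)) eq

  adjB-bounded : ∀ {k x y} → Attached k → T (adjB k x y) → x < order k × y < order k
  adjB-bounded {k} att xy with adjB-sound k xy
  ... | j , j<k , inj₁ e = let x< , y< = copyEdge-bounded (att j<k) e in ≤-trans x< (order-mono j<k) , ≤-trans y< (order-mono j<k)
  ... | j , j<k , inj₂ e = let y< , x< = copyEdge-bounded (att j<k) e in ≤-trans x< (order-mono j<k) , ≤-trans y< (order-mono j<k)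

  adjB-irreflexive : ∀ {k x} → Attached k → ¬ T (adjB k x x)
  adjB-irreflexive {k} att xx with adjB-sound k xx
  ... | j , j<k , inj₁ e = copyEdge-irreflexive (att j<k) e refl
  ... | j , j<k , inj₂ e = copyEdge-irreflexive (att j<k) e refl

  adjB-suc : ∀ k {x y} → T (adjB (suc k) x y) → T (adjB k x y) ⊎ Edge k x y
  adjB-suc k xy with adjB-sound (suc k) xy
  ... | j , j<1+k , e with j ≟ k
  ...   | yes refl = inj₂ e
  ...   | no j≢k = inj₁ (adjB-complete (≤∧≢⇒< (≤-pred j<1+k) j≢k) e)

  adjB-mono : ∀ {j k x y} → j ≤ k → T (adjB j x y) → T (adjB k x y)
  adjB-mono {j} j≤k xy with adjB-sound j xy
  ... | i , i<j , e = adjB-complete (<-≤-trans i<j j≤k) e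

  roleAdj⇔ : ∀ {i i′} → T (roleAdj i i′) ⇔ ((i < 2 × 2 ≤ i′) ⊎ (2 ≤ i × i′ < 2))
  roleAdj⇔ {i} {i′} = mk⇔
    (λ t → Sum.map (λ u → let a , b = to T-∧ u in <ᵇ⇒< i 2 a , ≤ᵇ⇒≤ 2 i′ b)
                   (λ u → let a , b = to T-∧ u in ≤ᵇ⇒≤ 2 i a , <ᵇ⇒< i′ 2 b) (to T-∨ t))
    (λ { (inj₁ (a , b)) → from T-∨ (inj₁ (from T-∧ (<⇒<ᵇ a , ≤⇒≤ᵇ b)))
       ; (inj₂ (a , b)) → from T-∨ (inj₂ (from T-∧ (≤⇒≤ᵇ a , <⇒<ᵇ b))) })

  module Layers {k} (att : Attached (suc k)) where

    pk<N : p k < order k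
    pk<N = att ≤-refl

    adjB-old : ∀ {x y} → x < order k → y < order k → adjB (suc k) x y ≡ adjB k x y
    adjB-old x<N y<N = T-injective restrict (adjB-mono (n≤1+n k))
      where
      restrict : T (adjB (suc k) _ _) → T (adjB k _ _)
      restrict xy with adjB-suc k xy
      ... | inj₁ xy′ = xy′
      ... | inj₂ (inj₁ e) = ⊥-elim (<⇒≱ y<N (copyEdge-target-new e))
      ... | inj₂ (inj₂ e) = ⊥-elim (<⇒≱ x<N (copyEdge-target-new e))

    adjB-attach : ∀ {x i} → x < order k → i < 5 → adjB (suc k) x (vertex k i) ≡ (i ≡ᵇ 2) ∧ (p k ≡ᵇ x)
    adjB-attach {x} {i} x<N i<5 = T-injective to-attach from-attach
      where
      to-attach : T (adjB (suc k) x (vertex k i)) → T ((i ≡ᵇ 2) ∧ (p k ≡ᵇ x))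
      to-attach xy with adjB-suc k xy
      ... | inj₁ xy′ = ⊥-elim (<⇒≱ (proj₂ (adjB-bounded (Attached-pred att) xy′)) (order≤vertex k i))
      ... | inj₂ (inj₂ e) = ⊥-elim (<⇒≱ x<N (copyEdge-target-new e))
      ... | inj₂ (inj₁ e) with copyEdge-source e
      ...   | inj₁ N≤x = ⊥-elim (<⇒≱ x<N N≤x)
      ...   | inj₂ (x≡pk , eq) = from T-∧ (≡⇒≡ᵇ i 2 (vertex-injective k eq) , ≡⇒≡ᵇ (p k) x (sym x≡pk))
      from-attach : T ((i ≡ᵇ 2) ∧ (p k ≡ᵇ x)) → T (adjB (suc k) x (vertex k i))
      from-attach t with to T-∧ t
      ... | i≡2 , pk≡x rewrite ≡ᵇ⇒≡ i 2 i≡2 | sym (≡ᵇ⇒≡ (p k) x pk≡x) = adjB-complete {k} ≤-refl (inj₁ attach)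

    adjB-attach′ : ∀ {x i} → x < order k → i < 5 → adjB (suc k) (vertex k i) x ≡ (i ≡ᵇ 2) ∧ (p k ≡ᵇ x)
    adjB-attach′ {x} {i} x<N i<5 = trans (adjB-sym (suc k) (vertex k i) x) (adjB-attach x<N i<5)

    adjB-new : ∀ {i i′} → i < 5 → i′ < 5 → adjB (suc k) (vertex k i) (vertex k i′) ≡ roleAdj i i′
    adjB-new {i} {i′} i<5 i′<5 = T-injective to-role from-role
      where
      roles : ∀ {x y a b} → CopyEdge k x y → x ≡ vertex k a → y ≡ vertex k b → a < 2 × 2 ≤ b
      roles (inner _ _ a₀<2 2≤b₀ _) eq eq′ =
        subst (_< 2) (vertex-injective k eq) a₀<2 , subst (2 ≤_) (vertex-injective k eq′) 2≤b₀
      roles {a = a} attach pk≡v _ = ⊥-elim (<⇒≱ pk<N (subst (order k ≤_) (sym pk≡v) (order≤vertex k a)))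
      to-role : T (adjB (suc k) (vertex k i) (vertex k i′)) → T (roleAdj i i′)
      to-role xy with adjB-suc k xy
      ... | inj₁ xy′ = ⊥-elim (<⇒≱ (proj₁ (adjB-bounded (Attached-pred att) xy′)) (order≤vertex k i))
      ... | inj₂ (inj₁ e) = from roleAdj⇔ (inj₁ (roles {a = i} {i′} e refl refl))
      ... | inj₂ (inj₂ e) = let i′<2 , 2≤i = roles {a = i′} {i} e refl refl in from roleAdj⇔ (inj₂ (2≤i , i′<2))
      from-role : T (roleAdj i i′) → T (adjB (suc k) (vertex k i) (vertex k i′))
      from-role t with to roleAdj⇔ t
      ... | inj₁ (i<2 , 2≤i′) = adjB-complete {k} ≤-refl (inj₁ (inner i i′ i<2 2≤i′ i′<5))
      ... | inj₂ (2≤i , i′<2) = adjB-complete {k} ≤-refl (inj₂ (inner i′ i i′<2 2≤i i<5))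

  degree : ℕ → ℕ → ℕ
  degree k x = count (order k) (adjB k x)

  attachments : ℕ → ℕ → ℕ
  attachments k x = count k (λ j → p j ≡ᵇ x)

  -- The degree of x inside its own copy of K_{2,3}; each copy attached to x adds one.
  baseDegree : ℕ → ℕ
  baseDegree zero = 0
  baseDegree (suc y) = if isCanon (suc y) then 2 else 3

  baseDegree-vertex : ∀ j {i} → i < 5 → baseDegree (vertex j i) ≡ (if (i ≡ᵇ 3) ∨ (i ≡ᵇ 4) then 2 else 3)
  baseDegree-vertex j i<5 = cong (if_then 2 else 3) (isCanon-vertex j i<5)

  roleDegree : ∀ {i} → i < 5 →
               ⟦ i ≡ᵇ 2 ⟧ + ∑< 5 (λ i′ → ⟦ roleAdj i i′ ⟧) ≡ (if (i ≡ᵇ 3) ∨ (i ≡ᵇ 4) then 2 else 3)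
  roleDegree {0} _ = refl
  roleDegree {1} _ = refl
  roleDegree {2} _ = refl
  roleDegree {3} _ = refl
  roleDegree {4} _ = refl
  roleDegree {suc (suc (suc (suc (suc _))))} (s≤s (s≤s (s≤s (s≤s (s≤s ())))))

  2≤baseDegree : ∀ {x} → x ≢ 0 → 2 ≤ baseDegree x
  2≤baseDegree {zero} x≢0 = ⊥-elim (x≢0 refl)
  2≤baseDegree {suc y} _ with isCanon (suc y)
  ... | true = ≤-refl
  ... | false = s≤s (s≤s z≤n)

  baseDegree≤2⇒canonical : ∀ x → baseDegree x ≤ 2 → T (isCanon x)
  baseDegree≤2⇒canonical zero _ = _
  baseDegree≤2⇒canonical (suc y) b≤2 with isCanon (suc y)
  ... | true = _
  ... | false = ⊥-elim (<⇒≱ (s≤s (s≤s (s≤s z≤n))) b≤2)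

  baseDegree-canonical : ∀ {x} → x ≢ 0 → T (isCanon x) → baseDegree x ≡ 2
  baseDegree-canonical {zero} x≢0 _ = ⊥-elim (x≢0 refl)
  baseDegree-canonical {suc y} _ canon rewrite to T-≡ canon = refl

  module Degrees {k} (att : Attached (suc k)) where
    open Layers att

    degree-old : ∀ {x} → x < order k → degree (suc k) x ≡ degree k x + ⟦ p k ≡ᵇ x ⟧
    degree-old {x} x<N = trans
      (∑<-order-suc k (λ i → ⟦ (i ≡ᵇ 2) ∧ (p k ≡ᵇ x) ⟧) (cong ⟦_⟧ ∘ adjB-old x<N) (cong ⟦_⟧ ∘ adjB-attach x<N))
      (cong (degree k x +_) (trans (+-identityʳ _) (+-identityʳ _)))

    degree-new : ∀ {i} → i < 5 → degree (suc k) (vertex k i) ≡ baseDegree (vertex k i)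
    degree-new {i} i<5 = begin
      degree (suc k) (vertex k i)
        ≡⟨ ∑<-order-suc k (λ i′ → ⟦ roleAdj i i′ ⟧) (λ y<N → cong ⟦_⟧ (adjB-attach′ y<N i<5))
                                                       (cong ⟦_⟧ ∘ adjB-new i<5) ⟩
      count (order k) (λ y → (i ≡ᵇ 2) ∧ (p k ≡ᵇ y)) + ∑< 5 (λ i′ → ⟦ roleAdj i i′ ⟧)
        ≡⟨ cong (_+ ∑< 5 (λ i′ → ⟦ roleAdj i i′ ⟧)) (count-∧-point (order k) (i ≡ᵇ 2) pk<N) ⟩
      ⟦ i ≡ᵇ 2 ⟧ + ∑< 5 (λ i′ → ⟦ roleAdj i i′ ⟧)
        ≡⟨ trans (roleDegree i<5) (sym (baseDegree-vertex k i<5)) ⟩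
      baseDegree (vertex k i) ∎
      where open ≡-Reasoning

  attachments-new : ∀ {k i} → Attached (suc k) → attachments (suc k) (vertex k i) ≡ 0
  attachments-new {k} {i} att = count-none (suc k) λ j<1+k →
    ≢⇒≡ᵇ-false (<⇒≢ (<-≤-trans (att j<1+k) (≤-trans (order-mono (≤-pred j<1+k)) (order≤vertex k i))))

  degree-formula : ∀ k {x} → Attached k → x < order k → degree k x ≡ baseDegree x + attachments k x
  degree-formula zero {zero} _ _ = refl
  degree-formula zero {suc _} _ (s≤s ())
  degree-formula (suc k) {x} att x<order with old-or-new k x<order
  ... | inj₁ x<N = begin
    degree (suc k) x                              ≡⟨ Degrees.degree-old att x<N ⟩
    degree k x + ⟦ p k ≡ᵇ x ⟧                     ≡⟨ cong (_+ ⟦ p k ≡ᵇ x ⟧) (degree-formula k (Attached-pred att) x<N) ⟩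
    baseDegree x + attachments k x + ⟦ p k ≡ᵇ x ⟧ ≡⟨ +-assoc (baseDegree x) _ _ ⟩
    baseDegree x + attachments (suc k) x          ∎
    where open ≡-Reasoning
  ... | inj₂ (i , i<5 , refl) = trans (Degrees.degree-new att i<5)
    (sym (trans (cong (baseDegree (vertex k i) +_) (attachments-new {k} {i} att)) (+-identityʳ _)))

  -- The lower bound

  record IsIDSᵇ (k : ℕ) (S D : ℕ → Bool) : Set where
    field
      ⊆S          : ∀ {x} → x < order k → T (D x) → T (S x)
      independent : ∀ {x y} → x < order k → y < order k → T (D x) → T (D y) → ¬ T (adjB k x y)
      dominating  : ∀ {x} → x < order k → T (S x) → ¬ T (D x) → ∃[ y ] y < order k × T (D y) × T (adjB k y x)

  IsIDSᵇ-cong : ∀ {k S S′ D D′} → (∀ {x} → x < order k → S x ≡ S′ x) → (∀ {x} → x < order k → D x ≡ D′ x) →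
                IsIDSᵇ k S D → IsIDSᵇ k S′ D′
  IsIDSᵇ-cong S≗ D≗ ids = record
    { ⊆S = λ x<N D′x → subst T (S≗ x<N) (⊆S x<N (subst T (sym (D≗ x<N)) D′x))
    ; independent = λ x<N y<N D′x D′y → independent x<N y<N (subst T (sym (D≗ x<N)) D′x) (subst T (sym (D≗ y<N)) D′y)
    ; dominating = λ x<N S′x ¬D′x →
        let y , y<N , Dy , a = dominating x<N (subst T (sym (S≗ x<N)) S′x) (¬D′x ∘ subst T (D≗ x<N))
        in y , y<N , subst T (D≗ y<N) Dy , a }
    where open IsIDSᵇ ids

  module Restriction {k} (att : Attached (suc k)) {S D} (ids : IsIDSᵇ (suc k) S D) where
    open IsIDSᵇ ids
    open Layers att

    restrict : (T (D (vertex k 2)) → T (S (p k)) → ¬ T (D (p k)) →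
                  ∃[ y ] y < order k × T (D y) × T (adjB k y (p k))) → IsIDSᵇ k S D
    restrict pk-dominated = record
      { ⊆S = ⊆S ∘ <order-suc
      ; independent = λ x<N y<N Dx Dy xy → independent (<order-suc x<N) (<order-suc y<N) Dx Dy (adjB-mono (n≤1+n k) xy)
      ; dominating = dominating′ }
      where
      dominating′ : ∀ {z} → z < order k → T (S z) → ¬ T (D z) → ∃[ y ] y < order k × T (D y) × T (adjB k y z)
      dominating′ {z} z<N Sz ¬Dz with dominating (<order-suc z<N) Sz ¬Dz
      ... | y , y<N′ , Dy , yz with old-or-new k y<N′
      ...   | inj₁ y<N = y , y<N , Dy , subst T (adjB-old y<N z<N) yz
      ...   | inj₂ (i , i<5 , refl) with to T-∧ (subst T (adjB-attach′ z<N i<5) yz)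
      ...     | i≡2 , pk≡z = subst (λ w → ∃[ y ] y < order k × T (D y) × T (adjB k y w)) pk≡z′
                  (pk-dominated (subst (T ∘ D ∘ vertex k) (≡ᵇ⇒≡ i 2 i≡2) Dy)
                                (subst (T ∘ S) (sym pk≡z′) Sz) (¬Dz ∘ subst (T ∘ D) pk≡z′))
        where
        pk≡z′ : p k ≡ z
        pk≡z′ = ≡ᵇ⇒≡ (p k) z pk≡z

    restrict-∪ : T (S (p k)) → (∀ {y} → y < order k → T (D y) → ¬ T (adjB k y (p k))) →
                 IsIDSᵇ k S (λ y → D y ∨ (y ≡ᵇ p k))
    restrict-∪ Spk pk-undominated = record { ⊆S = ⊆S′ ; independent = independent′ ; dominating = dominating′ }
      where
      ⊆S′ : ∀ {x} → x < order k → T (D x ∨ (x ≡ᵇ p k)) → T (S x)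
      ⊆S′ {x} x<N t with to T-∨ t
      ... | inj₁ Dx = ⊆S (<order-suc x<N) Dx
      ... | inj₂ x≡pk = subst (T ∘ S) (sym (≡ᵇ⇒≡ x (p k) x≡pk)) Spk
      independent′ : ∀ {x y} → x < order k → y < order k → T (D x ∨ (x ≡ᵇ p k)) → T (D y ∨ (y ≡ᵇ p k)) → ¬ T (adjB k x y)
      independent′ {x} {y} x<N y<N tx ty xy with to T-∨ tx | to T-∨ ty
      ... | inj₁ Dx | inj₁ Dy = independent (<order-suc x<N) (<order-suc y<N) Dx Dy (adjB-mono (n≤1+n k) xy)
      ... | inj₁ Dx | inj₂ y≡pk = pk-undominated x<N Dx (subst (T ∘ adjB k x) (≡ᵇ⇒≡ y (p k) y≡pk) xy)
      ... | inj₂ x≡pk | inj₁ Dy =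
        pk-undominated y<N Dy (subst T (trans (cong (λ w → adjB k w y) (≡ᵇ⇒≡ x (p k) x≡pk)) (adjB-sym k (p k) y)) xy)
      ... | inj₂ x≡pk | inj₂ y≡pk =
        adjB-irreflexive (Attached-pred att) (subst T (cong₂ (adjB k) (≡ᵇ⇒≡ x (p k) x≡pk) (≡ᵇ⇒≡ y (p k) y≡pk)) xy)
      dominating′ : ∀ {z} → z < order k → T (S z) → ¬ T (D z ∨ (z ≡ᵇ p k)) →
                    ∃[ y ] y < order k × T (D y ∨ (y ≡ᵇ p k)) × T (adjB k y z)
      dominating′ {z} z<N Sz ¬D′z with dominating (<order-suc z<N) Sz (¬D′z ∘ from T-∨ ∘ inj₁)
      ... | y , y<N′ , Dy , yz with old-or-new k y<N′
      ...   | inj₁ y<N = y , y<N , from T-∨ (inj₁ Dy) , subst T (adjB-old y<N z<N) yz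
      ...   | inj₂ (i , i<5 , refl) =
        ⊥-elim (¬D′z (from T-∨ (inj₂ (subst T (≡ᵇ-sym (p k) z) (proj₂ (to T-∧ (subst T (adjB-attach′ z<N i<5) yz)))))))

  module LowerBoundStep {k} (att : Attached (suc k)) {S D}
                        (S⊇nonCanon : ∀ {x} → x < order (suc k) → ¬ T (isCanon x) → T (S x))
                        (ids : IsIDSᵇ (suc k) S D) where
    open IsIDSᵇ ids
    open Layers att
    open Restriction att ids

    new : ℕ → ℕ
    new = vertex k

    new<order : ∀ {i} → i < 5 → new i < order (suc k)
    new<order i<5 = vertex<order _ ≤-refl i<5

    independent-new : ∀ {i i′} → i < 5 → i′ < 5 → T (roleAdj i i′) → T (D (new i)) → T (D (new i′)) → ⊥
    independent-new i<5 i′<5 r Di Di′ = independent (new<order i<5) (new<order i′<5) Di Di′ (subst T (sym (adjB-new i<5 i′<5)) r)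

    dominator-new : ∀ {i} → i < 5 → i ≢ 2 → T (S (new i)) → ¬ T (D (new i)) →
                    ∃[ i′ ] i′ < 5 × T (roleAdj i′ i) × T (D (new i′))
    dominator-new {i} i<5 i≢2 Si ¬Di with dominating (new<order i<5) Si ¬Di
    ... | y , y<N′ , Dy , yi with old-or-new k y<N′
    ...   | inj₁ y<N = ⊥-elim (i≢2 (≡ᵇ⇒≡ i 2 (proj₁ (to T-∧ (subst T (adjB-attach y<N i<5) yi)))))
    ...   | inj₂ (i′ , i′<5 , refl) = i′ , i′<5 , subst T (adjB-new i′<5 i<5) yi , Dy

    leaf-chosen : ∀ {i′} → 2 ≤ i′ → i′ < 5 → T (D (new i′)) → T (D (new 2)) ⊎ T (D (new 3)) ⊎ T (D (new 4))
    leaf-chosen {0} () _ _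
    leaf-chosen {1} (s≤s ()) _ _
    leaf-chosen {2} _ _ D2 = inj₁ D2
    leaf-chosen {3} _ _ D3 = inj₂ (inj₁ D3)
    leaf-chosen {4} _ _ D4 = inj₂ (inj₂ D4)
    leaf-chosen {suc (suc (suc (suc (suc _))))} _ (s≤s (s≤s (s≤s (s≤s (s≤s ()))))) _

    hub-chosen : ∀ {i′} → i′ < 2 → T (D (new i′)) → T (D (new 0)) ⊎ T (D (new 1))
    hub-chosen {0} _ D0 = inj₁ D0
    hub-chosen {1} _ D1 = inj₂ D1
    hub-chosen {suc (suc _)} (s≤s (s≤s ())) _

    hub-nonCanonical : ∀ {h} → h < 2 → ¬ T (isCanon (new h))
    hub-nonCanonical {0} _ = subst T (isCanon-vertex k 0<5)
    hub-nonCanonical {1} _ = subst T (isCanon-vertex k 1<5)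
    hub-nonCanonical {suc (suc _)} (s≤s (s≤s ()))

    hub-dominated : ∀ {h} → h < 2 → ¬ T (D (new h)) → T (D (new 2)) ⊎ T (D (new 3)) ⊎ T (D (new 4))
    hub-dominated {h} h<2 ¬Dh
      with dominator-new h<5 (<⇒≢ h<2) (S⊇nonCanon (new<order h<5) (hub-nonCanonical h<2)) ¬Dh
      where
      h<5 : h < 5
      h<5 = <-trans h<2 2<5
    ... | i′ , i′<5 , r , Di′ with to (roleAdj⇔ {i′} {h}) r
    ...   | inj₁ (_ , 2≤h) = ⊥-elim (<⇒≱ h<2 2≤h)
    ...   | inj₂ (2≤i′ , _) = leaf-chosen 2≤i′ i′<5 Di′

    leaf-dominated : ∀ {l} → 2 < l → l < 5 → T (S (new l)) → ¬ T (D (new l)) → T (D (new 0)) ⊎ T (D (new 1))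
    leaf-dominated {l} 2<l l<5 Sl ¬Dl with dominator-new l<5 (≢-sym (<⇒≢ 2<l)) Sl ¬Dl
    ... | i′ , i′<5 , r , Di′ with to (roleAdj⇔ {i′} {l}) r
    ...   | inj₁ (i′<2 , _) = hub-chosen i′<2 Di′
    ...   | inj₂ (_ , l<2) = ⊥-elim (<⇒≱ l<2 (<⇒≤ 2<l))

    hubs-exclude-leaves : T (D (new 0)) ⊎ T (D (new 1)) → ¬ (T (D (new 2)) ⊎ T (D (new 3)) ⊎ T (D (new 4)))
    hubs-exclude-leaves (inj₁ Da) (inj₁ Dc) = independent-new 0<5 2<5 _ Da Dc
    hubs-exclude-leaves (inj₁ Da) (inj₂ (inj₁ Dd)) = independent-new 0<5 3<5 _ Da Dd
    hubs-exclude-leaves (inj₁ Da) (inj₂ (inj₂ De)) = independent-new 0<5 4<5 _ Da De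
    hubs-exclude-leaves (inj₂ Db) (inj₁ Dc) = independent-new 1<5 2<5 _ Db Dc
    hubs-exclude-leaves (inj₂ Db) (inj₂ (inj₁ Dd)) = independent-new 1<5 3<5 _ Db Dd
    hubs-exclude-leaves (inj₂ Db) (inj₂ (inj₂ De)) = independent-new 1<5 4<5 _ Db De

    last-copy : ⟦ D (new 2) ⟧ + ⟦ S (new 3) ⟧ + ⟦ S (new 4) ⟧ ≤ ∑< 5 (λ i → ⟦ D (new i) ⟧)
    last-copy = k23-count hubs-exclude-leaves (hub-dominated (s≤s z≤n)) (hub-dominated ≤-refl)
                          (leaf-dominated ≤-refl 3<5) (leaf-dominated (s≤s (s≤s (s≤s z≤n))) 4<5)

    pk<N′ : p k < order (suc k)
    pk<N′ = <order-suc pk<N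

    pk-outside : D (new 2) ≡ true → D (p k) ≡ false
    pk-outside Dc with D (p k) in Dpk
    ... | false = refl
    ... | true = ⊥-elim (independent pk<N′ (new<order 2<5) (from T-≡ Dpk) (from T-≡ Dc) (adjB-complete {k} ≤-refl (inj₁ attach)))

    earlier-copies : (∀ {D′} → IsIDSᵇ k S D′ → count (order k) (λ x → isCanon x ∧ S x) ≤ count (order k) D′) →
                     count (order k) (λ x → isCanon x ∧ S x) ≤ count (order k) D + ⟦ D (new 2) ⟧
    earlier-copies ih with D (new 2) in Dc
    ... | false = ≤-trans (ih (restrict λ c∈D → ⊥-elim (subst T Dc c∈D))) (m≤m+n _ 0)
    ... | true with S (p k) in Spk
    ...   | false = ≤-trans (ih (restrict λ _ pk∈S → ⊥-elim (subst T Spk pk∈S))) (m≤m+n _ 1)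
    ...   | true with anyUpTo? (λ y → T? (D y ∧ adjB k y (p k))) (order k)
    ...     | yes (y , y<N , t) = ≤-trans (ih (restrict λ _ _ _ → y , y<N , to T-∧ t)) (m≤m+n _ 1)
    ...     | no undominated = begin
      count (order k) (λ x → isCanon x ∧ S x)
        ≤⟨ ih (restrict-∪ (from T-≡ Spk) λ y<N Dy a → undominated (_ , y<N , from T-∧ (Dy , a))) ⟩
      count (order k) (λ y → D y ∨ (y ≡ᵇ p k)) ≡⟨ count-∨-point D pk<N (pk-outside Dc) ⟩
      suc (count (order k) D)                  ≡⟨ +-comm 1 _ ⟩
      count (order k) D + 1                    ∎
      where open ≤-Reasoning

  lower-bound : ∀ k → Attached k → ∀ {S D} → (∀ {x} → x < order k → ¬ T (isCanon x) → T (S x)) →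
                IsIDSᵇ k S D → count (order k) (λ x → isCanon x ∧ S x) ≤ count (order k) D
  lower-bound zero _ {S} {D} _ ids = ⟦⟧-mono root-chosen
    where
    root-chosen : T (S 0) → T (D 0)
    root-chosen S0 with T? (D 0)
    ... | yes D0 = D0
    ... | no ¬D0 with IsIDSᵇ.dominating ids (s≤s z≤n) S0 ¬D0
    ...   | zero , _ , _ , ()
    ...   | suc _ , s≤s () , _
  lower-bound (suc k) att {S} {D} S⊇nonCanon ids = begin
    count (order (suc k)) (λ x → isCanon x ∧ S x)
      ≡⟨ ∑<-order-suc k (λ i → ⟦ ((i ≡ᵇ 3) ∨ (i ≡ᵇ 4)) ∧ S (new i) ⟧) (λ _ → refl)
                        (λ {i} i<5 → cong (λ b → ⟦ b ∧ S (new i) ⟧) (isCanon-vertex k i<5)) ⟩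
    count (order k) (λ x → isCanon x ∧ S x) + (⟦ S (new 3) ⟧ + ⟦ S (new 4) ⟧)
      ≤⟨ +-monoˡ-≤ _ (earlier-copies (lower-bound k (Attached-pred att) (S⊇nonCanon ∘ <order-suc))) ⟩
    count (order k) D + ⟦ D (new 2) ⟧ + (⟦ S (new 3) ⟧ + ⟦ S (new 4) ⟧)
      ≡⟨ reassoc (count (order k) D) _ _ _ ⟩
    count (order k) D + (⟦ D (new 2) ⟧ + ⟦ S (new 3) ⟧ + ⟦ S (new 4) ⟧)
      ≤⟨ +-monoʳ-≤ (count (order k) D) last-copy ⟩
    count (order k) D + ∑< 5 (λ i → ⟦ D (new i) ⟧)
      ≡⟨ sym (∑<-order-suc k _ (λ _ → refl) (λ _ → refl)) ⟩
    count (order (suc k)) D ∎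
    where
    open ≤-Reasoning
    open LowerBoundStep att S⊇nonCanon ids
    reassoc : ∀ a b c d → a + b + (c + d) ≡ a + (b + c + d)
    reassoc = solve-∀

  module DegreeFacts {K} (att : Attached K) where

    3≤degree : ∀ {j i} → j < K → i < 3 → 3 ≤ degree K (vertex j i)
    3≤degree {j} {i} j<K i<3 = begin
      3                                                   ≡⟨ cong (if_then 2 else 3) (sym (isCanon-hub-or-core j i<3)) ⟩
      baseDegree (vertex j i)                             ≤⟨ m≤m+n _ _ ⟩
      baseDegree (vertex j i) + attachments K (vertex j i) ≡⟨ sym (degree-formula K att (vertex<order i j<K (<-trans i<3 3<5))) ⟩
      degree K (vertex j i)                               ∎
      where open ≤-Reasoning

    2≤degree : ∀ {x} → x < order K → x ≢ 0 → 2 ≤ degree K x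
    2≤degree x<N x≢0 = ≤-trans (≤-trans (2≤baseDegree x≢0) (m≤m+n _ _)) (≤-reflexive (sym (degree-formula K att x<N)))

    degree≤2⇒canonical : ∀ {x} → x < order K → degree K x ≤ 2 → T (isCanon x)
    degree≤2⇒canonical {x} x<N d≤2 =
      baseDegree≤2⇒canonical x (≤-trans (m≤m+n _ _) (≤-trans (≤-reflexive (sym (degree-formula K att x<N))) d≤2))

    degree≡2⇒unattached : ∀ {x} → x < order K → x ≢ 0 → degree K x ≡ 2 → ∀ {j} → j < K → p j ≢ x
    degree≡2⇒unattached {x} x<N x≢0 d≡2 j<K pj≡x =
      <-irrefl refl (≤-trans (witness-count j<K (≡⇒≡ᵇ (p _) x pj≡x)) no-attachments)
      where
      no-attachments : attachments K x ≤ 0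
      no-attachments = +-cancelˡ-≤ 2 _ _ (begin
        2 + attachments K x            ≤⟨ +-monoˡ-≤ _ (2≤baseDegree x≢0) ⟩
        baseDegree x + attachments K x ≡⟨ sym (degree-formula K att x<N) ⟩
        degree K x                     ≡⟨ d≡2 ⟩
        2                              ≡⟨ +-identityʳ 2 ⟨
        2 + 0                          ∎)
        where open ≤-Reasoning

    degree≢2⇒attached : ∀ {x} → x < order K → x ≢ 0 → T (isCanon x) → degree K x ≢ 2 → ∃[ j ] j < K × p j ≡ x
    degree≢2⇒attached {x} x<N x≢0 canon d≢2 with count-witness K (≰⇒> attached)
      where
      attached : attachments K x ≰ 0
      attached a≤0 = d≢2 (trans (degree-formula K att x<N) (cong₂ _+_ (baseDegree-canonical x≢0 canon) (n≤0⇒n≡0 a≤0)))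
    ... | j , j<K , pj≡x = j , j<K , ≡ᵇ⇒≡ (p j) x pj≡x

    count-degree-1≤1 : count (order K) (λ x → degree K x ≡ᵇ 1) ≤ 1
    count-degree-1≤1 = ≤-trans (count-mono (order K) leaf⇒root) (≤-reflexive (count-point {order K} (s≤s z≤n)))
      where
      leaf⇒root : ∀ {x} → x < order K → T (degree K x ≡ᵇ 1) → T (x ≡ᵇ 0)
      leaf⇒root {x} x<N d≡1 with x ≟ 0
      ... | yes x≡0 = ≡⇒≡ᵇ x 0 x≡0
      ... | no x≢0 = ⊥-elim (<⇒≱ (s≤s (s≤s z≤n)) (subst (2 ≤_) (≡ᵇ⇒≡ _ 1 d≡1) (2≤degree x<N x≢0)))

    copyEdge-meets-degree-3 : ∀ {j x y} → j < K → CopyEdge j x y → degree K x ≡ 2 → degree K y ≡ 2 → ⊥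
    copyEdge-meets-degree-3 j<K (inner _ _ i<2 _ _) dx _ = <-irrefl (sym dx) (3≤degree j<K (m<n⇒m<1+n i<2))
    copyEdge-meets-degree-3 j<K attach _ dy = <-irrefl (sym dy) (3≤degree j<K ≤-refl)

    no-adjacent-degree-2 : ∀ {x y} → T (adjB K x y) → degree K x ≡ 2 → degree K y ≡ 2 → ⊥
    no-adjacent-degree-2 xy dx dy with adjB-sound K xy
    ... | j , j<K , inj₁ e = copyEdge-meets-degree-3 j<K e dx dy
    ... | j , j<K , inj₂ e = copyEdge-meets-degree-3 j<K e dy dx

  -- Independent dominating sets attaining the bound

  module Constructions {K} (att : Attached K) (canonical-attachments : ∀ {j} → j < K → T (isCanon (p j))) where
    open DegreeFacts att

    independent-by-edges : ∀ {D : ℕ → Bool} → (∀ {j x y} → j < K → CopyEdge j x y → T (D x) → T (D y) → ⊥) →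
                           ∀ {x y} → x < order K → y < order K → T (D x) → T (D y) → ¬ T (adjB K x y)
    independent-by-edges no-edge _ _ Dx Dy xy with adjB-sound K xy
    ... | j , j<K , inj₁ e = no-edge j<K e Dx Dy
    ... | j , j<K , inj₂ e = no-edge j<K e Dy Dx

    edge : ∀ {j x y} → j < K → CopyEdge j x y → T (adjB K x y)
    edge j<K e = adjB-complete j<K (inj₁ e)

    edge′ : ∀ {j x y} → j < K → CopyEdge j y x → T (adjB K x y)
    edge′ j<K e = adjB-complete j<K (inj₂ e)

    canonical-no-edge : ∀ {j x y} → j < K → CopyEdge j x y → T (isCanon x) → T (isCanon y) → ⊥
    canonical-no-edge {j} _ (inner _ _ i<2 _ _) cx _ = subst T (isCanon-hub-or-core j (m<n⇒m<1+n i<2)) cx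
    canonical-no-edge {j} _ attach _ cy = subst T (isCanon-hub-or-core j ≤-refl) cy

    nonCanonical-root-no-edge : ∀ {j x y} → j < K → CopyEdge j x y →
                                T (isNonCanon x ∨ (x ≡ᵇ 0)) → T (isNonCanon y ∨ (y ≡ᵇ 0)) → ⊥
    nonCanonical-root-no-edge {j} _ (inner _ _ _ 2≤i′ i′<5) _ ny = subst (λ b → T (b ∨ false)) (isNonCanon-leaf j 2≤i′ i′<5) ny
    nonCanonical-root-no-edge {j} _ attach _ ny = subst (λ b → T (b ∨ false)) (isNonCanon-leaf j ≤-refl 2<5) ny

    core-no-edge : ∀ {j x y} → j < K → CopyEdge j x y → T (isCore x) → T (isCore y) → ⊥
    core-no-edge {j} _ (inner _ _ i<2 _ _) cx _ = subst T (isCore-hub j i<2) cx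
    core-no-edge {j} j<K attach cx _ = canonical⇒¬core (p j) (canonical-attachments j<K) cx

    hub-canonical-dominator : ∀ v {j h} → j < K → h < 2 → ∃[ y ] y < order K × T (isCanon y) × y ≢ v × T (adjB K y (vertex j h))
    hub-canonical-dominator v {j} {h} j<K h<2 with vertex j 3 ≟ v
    ... | no d≢v = vertex j 3 , vertex<order 3 j<K 3<5 , subst T (sym (isCanon-vertex j 3<5)) _ , d≢v ,
                   edge′ j<K (inner h 3 h<2 (s≤s (s≤s z≤n)) 3<5)
    ... | yes d≡v = vertex j 4 , vertex<order 4 j<K 4<5 , subst T (sym (isCanon-vertex j 4<5)) _ ,
                    (λ e≡v → 4≢3 (vertex-injective j (trans e≡v (sym d≡v)))) , edge′ j<K (inner h 4 h<2 (s≤s (s≤s z≤n)) 4<5)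
      where
      4≢3 : 4 ≢ 3
      4≢3 ()

    canonical-dominator : ∀ {x} v → (∀ {j} → j < K → p j ≢ v) → x < order K → ¬ T (isCanon x) →
                          ∃[ y ] y < order K × T (isCanon y) × y ≢ v × T (adjB K y x)
    canonical-dominator v v-unattached x<N ¬canon with vertexView K x<N
    ... | atRoot = ⊥-elim (¬canon _)
    ... | inCopy 0 j<K _ = hub-canonical-dominator v j<K (s≤s z≤n)
    ... | inCopy 1 j<K _ = hub-canonical-dominator v j<K ≤-refl
    ... | inCopy 2 j<K _ = p _ , <-≤-trans (att j<K) (order-mono (<⇒≤ j<K)) , canonical-attachments j<K , v-unattached j<K , edge j<K attach
    ... | inCopy {j} 3 _ _ = ⊥-elim (¬canon (subst T (sym (isCanon-vertex j 3<5)) _))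
    ... | inCopy {j} 4 _ _ = ⊥-elim (¬canon (subst T (sym (isCanon-vertex j 4<5)) _))
    ... | inCopy (suc (suc (suc (suc (suc _))))) _ (s≤s (s≤s (s≤s (s≤s (s≤s ())))))

    nonCanonical-dominator : ∀ {x} → x < order K → x ≢ 0 → ¬ T (isNonCanon x) →
                             ∃[ y ] y < order K × T (isNonCanon y) × T (adjB K y x)
    nonCanonical-dominator x<N x≢0 ¬nonCanon with vertexView K x<N
    ... | atRoot = ⊥-elim (x≢0 refl)
    ... | inCopy {j} 0 _ _ = ⊥-elim (¬nonCanon (subst T (sym (isNonCanon-vertex j 0<5)) _))
    ... | inCopy {j} 1 _ _ = ⊥-elim (¬nonCanon (subst T (sym (isNonCanon-vertex j 1<5)) _))
    ... | inCopy {j} (suc (suc i)) j<K i<5 =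
      vertex j 0 , vertex<order 0 j<K 0<5 , subst T (sym (isNonCanon-vertex j 0<5)) _ ,
      edge j<K (inner 0 (suc (suc i)) (s≤s z≤n) (s≤s (s≤s z≤n)) i<5)

    core-dominates : ∀ {j x} → j < K → T (adjB K (vertex j 2) x) → ∃[ y ] y < order K × T (isCore y) × T (adjB K y x)
    core-dominates {j} j<K a = vertex j 2 , vertex<order 2 j<K 2<5 , subst T (sym (isCore-vertex j 2<5)) _ , a

    core-dominates-attachment : ∀ {x} → ∃[ j ] j < K × p j ≡ x → ∃[ y ] y < order K × T (isCore y) × T (adjB K y x)
    core-dominates-attachment (j , j<K , pj≡x) = core-dominates j<K (subst (T ∘ adjB K (vertex j 2)) pj≡x (edge′ j<K attach))

    core-dominator : p 0 ≡ 0 → 1 ≤ K → ∀ {x} → x < order K → degree K x ≢ 2 → ¬ T (isCore x) →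
                     ∃[ y ] y < order K × T (isCore y) × T (adjB K y x)
    core-dominator root-attached K≥1 x<N d≢2 ¬core with vertexView K x<N
    ... | atRoot = core-dominates-attachment (0 , K≥1 , root-attached)
    ... | inCopy {j} 0 j<K _ = core-dominates j<K (edge′ j<K (inner 0 2 (s≤s z≤n) ≤-refl 2<5))
    ... | inCopy {j} 1 j<K _ = core-dominates j<K (edge′ j<K (inner 1 2 ≤-refl ≤-refl 2<5))
    ... | inCopy {j} 2 _ _ = ⊥-elim (¬core (subst T (sym (isCore-vertex j 2<5)) _))
    ... | inCopy {j} 3 _ _ = core-dominates-attachment (degree≢2⇒attached x<N (λ ()) (subst T (sym (isCanon-vertex j 3<5)) _) d≢2)
    ... | inCopy {j} 4 _ _ = core-dominates-attachment (degree≢2⇒attached x<N (λ ()) (subst T (sym (isCanon-vertex j 4<5)) _) d≢2)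
    ... | inCopy (suc (suc (suc (suc (suc _))))) _ (s≤s (s≤s (s≤s (s≤s (s≤s ())))))

    canonical-except-IDS : ∀ {v} → (∀ {j} → j < K → p j ≢ v) →
                           IsIDSᵇ K (λ x → not (x ≡ᵇ v)) (λ x → isCanon x ∧ not (x ≡ᵇ v))
    canonical-except-IDS {v} v-unattached = record
      { ⊆S = λ _ → proj₂ ∘ to T-∧
      ; independent = λ x<N y<N Dx Dy → independent-by-edges canonical-no-edge x<N y<N (proj₁ (to T-∧ Dx)) (proj₁ (to T-∧ Dy))
      ; dominating = dominating }
      where
      dominating : ∀ {x} → x < order K → T (not (x ≡ᵇ v)) → ¬ T (isCanon x ∧ not (x ≡ᵇ v)) →
                   ∃[ y ] y < order K × T (isCanon y ∧ not (y ≡ᵇ v)) × T (adjB K y x)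
      dominating x<N x≢v ¬Dx with canonical-dominator v v-unattached x<N (λ canon → ¬Dx (from T-∧ (canon , x≢v)))
      ... | y , y<N , canon , y≢v , a = y , y<N , from T-∧ (canon , subst (T ∘ not) (sym (≢⇒≡ᵇ-false y≢v)) _) , a

    canonical-IDS : IsIDSᵇ K (λ _ → true) isCanon
    canonical-IDS = record
      { ⊆S = λ _ _ → _
      ; independent = independent-by-edges canonical-no-edge
      ; dominating = λ x<N _ → dominating x<N }
      where
      dominating : ∀ {x} → x < order K → ¬ T (isCanon x) → ∃[ y ] y < order K × T (isCanon y) × T (adjB K y x)
      -- the label order K is not a vertex, so nothing is attached to it
      dominating x<N ¬canon with canonical-dominator (order K) (λ j<K → <⇒≢ (<-≤-trans (att j<K) (order-mono (<⇒≤ j<K)))) x<N ¬canon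
      ... | y , y<N , canon , _ , a = y , y<N , canon , a

    nonCanonical-root-IDS : IsIDSᵇ K (λ _ → true) (λ x → isNonCanon x ∨ (x ≡ᵇ 0))
    nonCanonical-root-IDS = record
      { ⊆S = λ _ _ → _
      ; independent = independent-by-edges nonCanonical-root-no-edge
      ; dominating = λ x<N _ → dominating x<N }
      where
      dominating : ∀ {x} → x < order K → ¬ T (isNonCanon x ∨ (x ≡ᵇ 0)) →
                   ∃[ y ] y < order K × T (isNonCanon y ∨ (y ≡ᵇ 0)) × T (adjB K y x)
      dominating {x} x<N ¬D with nonCanonical-dominator x<N (¬D ∘ from T-∨ ∘ inj₂ ∘ ≡⇒≡ᵇ x 0) (¬D ∘ from T-∨ ∘ inj₁)
      ... | y , y<N , nonCanon , a = y , y<N , from T-∨ (inj₁ nonCanon) , a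

    nonCanonical-IDS : IsIDSᵇ K (λ x → not (x ≡ᵇ 0)) isNonCanon
    nonCanonical-IDS = record
      { ⊆S = ⊆S
      ; independent = λ x<N y<N Dx Dy →
          independent-by-edges nonCanonical-root-no-edge x<N y<N (from T-∨ (inj₁ Dx)) (from T-∨ (inj₁ Dy))
      ; dominating = dominating }
      where
      ⊆S : ∀ {x} → x < order K → T (isNonCanon x) → T (not (x ≡ᵇ 0))
      ⊆S {suc _} _ _ = _
      dominating : ∀ {x} → x < order K → T (not (x ≡ᵇ 0)) → ¬ T (isNonCanon x) →
                   ∃[ y ] y < order K × T (isNonCanon y) × T (adjB K y x)
      dominating {suc _} x<N _ = nonCanonical-dominator x<N (λ ())

    core-IDS : p 0 ≡ 0 → 1 ≤ K → IsIDSᵇ K (λ x → not (degree K x ≡ᵇ 2)) isCore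
    core-IDS root-attached K≥1 = record
      { ⊆S = ⊆S
      ; independent = independent-by-edges core-no-edge
      ; dominating = λ x<N S → core-dominator root-attached K≥1 x<N (λ d≡2 → subst (λ d → T (not (d ≡ᵇ 2))) d≡2 S) }
      where
      ⊆S : ∀ {x} → x < order K → T (isCore x) → T (not (degree K x ≡ᵇ 2))
      ⊆S x<N core with vertexView K x<N
      ... | atRoot = ⊥-elim core
      ... | inCopy {j} i j<K i<5 with ≡ᵇ⇒≡ i 2 (subst T (isCore-vertex j i<5) core)
      ...   | refl = subst (T ∘ not) (sym (≢⇒≡ᵇ-false (≢-sym (<⇒≢ (3≤degree j<K ≤-refl))))) _

  -- Weight

  module Weight {K} (att : Attached K) (root-attached : p 0 ≡ 0)
                (attachment-degree : ∀ {j} → 1 ≤ j → j < K → degree j (p j) ≤ 2) where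

    degreeWeight : ℕ → ℕ
    degreeWeight k = ∑< (order k) (λ x → wdeg (degree k x))

    wdeg-suc : ∀ {d} → 1 ≤ d → d ≤ 2 → wdeg (d + 1) + 1 ≡ wdeg d
    wdeg-suc {1} _ _ = refl
    wdeg-suc {2} _ _ = refl
    wdeg-suc {suc (suc (suc _))} _ (s≤s (s≤s ()))

    1≤attachment-degree : ∀ {k} → 1 ≤ k → k < K → 1 ≤ degree k (p k)
    1≤attachment-degree {k} k≥1 k<K with p k ≟ 0
    ... | no pk≢0 = ≤-trans (s≤s z≤n) (DegreeFacts.2≤degree (Attached-≤ (<⇒≤ k<K) att) (att k<K) pk≢0)
    ... | yes pk≡0 = begin
      1                                          ≤⟨ witness-count k≥1 (≡⇒≡ᵇ (p 0) (p k) (trans root-attached (sym pk≡0))) ⟩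
      attachments k (p k)                        ≤⟨ m≤n+m _ _ ⟩
      baseDegree (p k) + attachments k (p k)     ≡⟨ degree-formula k (Attached-≤ (<⇒≤ k<K) att) (att k<K) ⟨
      degree k (p k)                             ∎
      where open ≤-Reasoning

    weight-new : ∀ {k} → k < K → degreeWeight (suc k) ≡ ∑< (order k) (λ x → wdeg (degree (suc k) x)) + 17
    weight-new {k} k<K = ∑<-order-suc k (λ i → wdeg (if (i ≡ᵇ 3) ∨ (i ≡ᵇ 4) then 2 else 3)) (λ _ → refl)
      (λ i<5 → cong wdeg (trans (Degrees.degree-new (Attached-≤ k<K att) i<5) (baseDegree-vertex k i<5)))

    -- Copy k raises only the degree of p k, from 1 or 2, which lowers its weight by one.
    weight-old : ∀ {k} → 1 ≤ k → k < K → ∑< (order k) (λ x → wdeg (degree (suc k) x)) + 1 ≡ degreeWeight k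
    weight-old {k} k≥1 k<K = begin
      ∑< (order k) (λ x → wdeg (degree (suc k) x)) + 1
        ≡⟨ cong (∑< (order k) (λ x → wdeg (degree (suc k) x)) +_) (count-∧-point (order k) true pk<N) ⟨
      ∑< (order k) (λ x → wdeg (degree (suc k) x)) + count (order k) (p k ≡ᵇ_)
        ≡⟨ ∑<-+ (order k) _ _ ⟨
      ∑< (order k) (λ x → wdeg (degree (suc k) x) + ⟦ p k ≡ᵇ x ⟧)
        ≡⟨ ∑<-cong (order k) pointwise ⟩
      degreeWeight k ∎
      where
      open ≡-Reasoning
      pk<N : p k < order k
      pk<N = att k<K
      pointwise : ∀ {x} → x < order k → wdeg (degree (suc k) x) + ⟦ p k ≡ᵇ x ⟧ ≡ wdeg (degree k x)
      pointwise {x} x<N rewrite Degrees.degree-old (Attached-≤ k<K att) x<N with p k ≟ x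
      ... | yes refl rewrite ≡ᵇ-refl (p k) = wdeg-suc (1≤attachment-degree k≥1 k<K) (attachment-degree k≥1 k<K)
      ... | no pk≢x rewrite ≢⇒≡ᵇ-false pk≢x = trans (+-identityʳ _) (cong wdeg (+-identityʳ (degree k x)))

    weight-formula : ∀ {k} → 1 ≤ k → k ≤ K → degreeWeight k ≡ 16 * k + 6
    weight-formula {1} _ 1≤K = trans (weight-new 1≤K) (cong (λ d → wdeg d + 17) degree-root)
      where
      degree-root : degree 1 0 ≡ 1
      degree-root = trans (Degrees.degree-old (Attached-≤ 1≤K att) (s≤s z≤n)) (cong (λ r → ⟦ r ≡ᵇ 0 ⟧) root-attached)
    weight-formula {suc (suc k)} _ k+2≤K = begin
      degreeWeight (suc (suc k))                                          ≡⟨ weight-new k+2≤K ⟩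
      ∑< (order (suc k)) (λ x → wdeg (degree (suc (suc k)) x)) + 17 ≡⟨ +-assoc _ 1 16 ⟨
      ∑< (order (suc k)) (λ x → wdeg (degree (suc (suc k)) x)) + 1 + 16 ≡⟨ cong (_+ 16) (weight-old (s≤s z≤n) k+2≤K) ⟩
      degreeWeight (suc k) + 16                                           ≡⟨ cong (_+ 16) (weight-formula (s≤s z≤n) (<⇒≤ k+2≤K)) ⟩
      16 * suc k + 6 + 16                                            ≡⟨ arith k ⟩
      16 * suc (suc k) + 6                                           ∎
      where
      open ≡-Reasoning
      arith : ∀ k → 16 * suc k + 6 + 16 ≡ 16 * suc (suc k) + 6
      arith = solve-∀

  module OnFin (k : ℕ) where

    G : Graph
    G = B p k

    deg≡degree : ∀ u → deg G u ≡ degree k (toℕ u)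
    deg≡degree u = ∣tabulate∣ (order k) (adjB k (toℕ u))

    by-deg : (ℕ → Bool) → Subset (order k)
    by-deg g = tabulate (λ u → g (deg G u))

    member-by-deg : ∀ g {x} → x < order k → member (by-deg g) x ≡ g (degree k x)
    member-by-deg g {x} x<N = trans (member-tabulate (order k) (λ y → g ∣ tabulate {n = order k} (λ u → adjB k y (toℕ u)) ∣) x<N)
                                    (cong g (∣tabulate∣ (order k) (adjB k x)))

    ∣by-deg∣ : ∀ g → ∣ by-deg g ∣ ≡ count (order k) (g ∘ degree k)
    ∣by-deg∣ g = trans (∣tabulate∣ (order k) (λ y → g ∣ tabulate {n = order k} (λ u → adjB k y (toℕ u)) ∣))
                       (∑<-cong (order k) (λ {x} _ → cong (λ d → ⟦ g d ⟧) (∣tabulate∣ (order k) (adjB k x))))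

    IsIDS⇒IsIDSᵇ : ∀ {S D} → IsIDS G S D → IsIDSᵇ k (member S) (member D)
    IsIDS⇒IsIDSᵇ {S} {D} (D⊆S , independent , dominating) = record
      { ⊆S = ⊆S′ ; independent = independent′ ; dominating = dominating′ }
      where
      ⊆S′ : ∀ {x} → x < order k → T (member D x) → T (member S x)
      ⊆S′ x<N Dx with fromℕ< x<N | toℕ-fromℕ< x<N
      ... | u | refl = to ∈⇔member (D⊆S (from ∈⇔member Dx))
      independent′ : ∀ {x y} → x < order k → y < order k → T (member D x) → T (member D y) → ¬ T (adjB k x y)
      independent′ x<N y<N Dx Dy with fromℕ< x<N | toℕ-fromℕ< x<N | fromℕ< y<N | toℕ-fromℕ< y<N
      ... | u | refl | v | refl = subst T (independent u v (from ∈⇔member Dx) (from ∈⇔member Dy))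
      dominating′ : ∀ {x} → x < order k → T (member S x) → ¬ T (member D x) →
                    ∃[ y ] y < order k × T (member D y) × T (adjB k y x)
      dominating′ x<N Sx ¬Dx with fromℕ< x<N | toℕ-fromℕ< x<N
      ... | u | refl with dominating u (from ∈⇔member Sx) (¬Dx ∘ to ∈⇔member)
      ...   | w , w∈D , wu = toℕ w , toℕ<n w , to ∈⇔member w∈D , from T-≡ wu

    IsIDSᵇ⇒IsIDS : ∀ {S D} → IsIDSᵇ k (member S) (member D) → IsIDS G S D
    IsIDSᵇ⇒IsIDS {S} {D} ids =
      (λ {u} u∈D → from ∈⇔member (⊆S (toℕ<n u) (to ∈⇔member u∈D))) ,
      (λ u v u∈D v∈D → ¬T⇒≡false (independent (toℕ<n u) (toℕ<n v) (to ∈⇔member u∈D) (to ∈⇔member v∈D))) ,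
      dominating′
      where
      open IsIDSᵇ ids
      dominating′ : ∀ u → u ∈ S → u ∉ D → Σ (Fin (order k)) λ w → w ∈ D × adj G w u ≡ true
      dominating′ u u∈S u∉D with dominating (toℕ<n u) (to ∈⇔member u∈S) (u∉D ∘ from ∈⇔member)
      ... | y , y<N , Dy , yu with fromℕ< y<N | toℕ-fromℕ< y<N
      ...   | w | refl = w , from ∈⇔member Dy , to T-≡ yu

module ValidSequence (p : ℕ → ℕ) (k : ℕ) (k≥1 : 1 ≤ k) (valid : ValidSeq p k) where
  open Family p
  open OnFin k

  root-attached : p 0 ≡ 0
  root-attached = proj₁ valid

  attached : Attached k
  attached {zero} _ = subst (_< 1) (sym root-attached) (s≤s z≤n)
  attached {suc j} j<k = proj₁ (proj₂ valid (suc j) (s≤s z≤n) j<k)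

  attachment-degree : ∀ {j} → 1 ≤ j → j < k → degree j (p j) ≤ 2
  attachment-degree {j} j≥1 j<k with proj₂ valid j j≥1 j<k
  ... | pj<N , d≤2 = subst (_≤ 2) (trans (OnFin.deg≡degree j (fromℕ< pj<N)) (cong (degree j) (toℕ-fromℕ< pj<N))) d≤2

  canonical-attachments : ∀ {j} → j < k → T (isCanon (p j))
  canonical-attachments {zero} _ = subst (T ∘ isCanon) (sym root-attached) _
  canonical-attachments {suc j} j<k =
    DegreeFacts.degree≤2⇒canonical (Attached-≤ (<⇒≤ j<k) attached) (attached j<k) (attachment-degree (s≤s z≤n) j<k)

  open DegreeFacts attached
  open Constructions attached canonical-attachments

  fromIsIDSᵇ : ∀ {S D S′ D′} → (∀ {x} → x < order k → S′ x ≡ member S x) →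
               (∀ {x} → x < order k → D′ x ≡ member D x) → IsIDSᵇ k S′ D′ → IsIDS G S D
  fromIsIDSᵇ S≗ D≗ = IsIDSᵇ⇒IsIDS ∘ IsIDSᵇ-cong S≗ D≗

  lower-bound-on : ∀ {S D} (S′ : ℕ → Bool) → (∀ {x} → x < order k → member S x ≡ S′ x) →
                   (∀ {x} → x < order k → ¬ T (isCanon x) → T (S′ x)) → IsIDS G S D →
                   count (order k) (λ x → isCanon x ∧ S′ x) ≤ ∣ D ∣
  lower-bound-on {D = D} S′ S≗ S′⊇nonCanon ids =
    ≤-trans (lower-bound k attached S′⊇nonCanon (IsIDSᵇ-cong S≗ (λ _ → refl) (IsIDS⇒IsIDSᵇ ids)))
            (≤-reflexive (sym (∣∣≡count D)))

  minimum : ∀ {S D m} → IsIDS G S D → ∣ D ∣ ≡ m → (∀ {D′} → IsIDS G S D′ → m ≤ ∣ D′ ∣) → IsMinIDS G S D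
  minimum ids size≡m lower = ids , λ _ ids′ → ≤-trans (≤-reflexive size≡m) (lower ids′)

  2k+1≤∣IDS∣ : ∀ {D} → IsIDS G ⊤ D → 2 * k + 1 ≤ ∣ D ∣
  2k+1≤∣IDS∣ {D} ids = subst (_≤ ∣ D ∣) (trans (∑<-cong (order k) (λ _ → cong ⟦_⟧ (∧-identityʳ _))) (count-canonical k))
                    (lower-bound-on (λ _ → true) member-⊤ (λ _ _ → _) ids)

  canonical-size : ∣ canonicalSet p k ∣ ≡ 2 * k + 1
  canonical-size = trans (∣tabulate∣ (order k) isCanon) (count-canonical k)

  canonical-minimum : IsMinIDS G ⊤ (canonicalSet p k)
  canonical-minimum =
    minimum (fromIsIDSᵇ (sym ∘ member-⊤) (sym ∘ member-tabulate (order k) isCanon) canonical-IDS) canonical-size 2k+1≤∣IDS∣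

  i≡2k+1 : IsIndDomNum G ⊤ (2 * k + 1)
  i≡2k+1 = canonicalSet p k , canonical-minimum , canonical-size

  i≡m⇒m≡2k+1 : ∀ {m} → IsIndDomNum G ⊤ m → m ≡ 2 * k + 1
  i≡m⇒m≡2k+1 (D , (ids , minimal) , size≡m) =
    ≤-antisym (≤-trans (≤-reflexive (sym size≡m)) (≤-trans (minimal _ (proj₁ canonical-minimum)) (≤-reflexive canonical-size)))
              (≤-trans (2k+1≤∣IDS∣ ids) (≤-reflexive size≡m))

  weight-G : weight G ≡ 16 * k + 6
  weight-G = trans (sum-tabulate (order k) (λ x → wdeg (∣ tabulate {n = order k} (λ u → adjB k x (toℕ u)) ∣)))
                   (trans (∑<-cong (order k) (λ {x} _ → cong wdeg (∣tabulate∣ (order k) (adjB k x))))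
                          (Weight.weight-formula attached root-attached attachment-degree k≥1 ≤-refl))

  8i≡w+2 : ∀ m → IsIndDomNum G ⊤ m → 8 * m ≡ weight G + 2
  8i≡w+2 m i≡m = trans (cong (8 *_) (i≡m⇒m≡2k+1 i≡m)) (trans (arith k) (cong (_+ 2) (sym weight-G)))
    where
    arith : ∀ k → 8 * (2 * k + 1) ≡ 16 * k + 6 + 2
    arith = solve-∀

  nonCanonical-root-minimum : IsMinIDS G ⊤ (nonCanonicalSet p k ∪ ⁅ root p k ⁆)
  nonCanonical-root-minimum = minimum (fromIsIDSᵇ (sym ∘ member-⊤) member-D nonCanonical-root-IDS) size 2k+1≤∣IDS∣
    where
    D : Subset (order k)
    D = nonCanonicalSet p k ∪ ⁅ root p k ⁆
    member-D : ∀ {x} → x < order k → isNonCanon x ∨ (x ≡ᵇ 0) ≡ member D x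
    member-D {x} x<N = sym (trans (member-∪ (nonCanonicalSet p k) ⁅ root p k ⁆ x)
                                  (cong₂ _∨_ (member-tabulate (order k) isNonCanon x<N) (member-⁅⁆ (root p k) x)))
    size : ∣ D ∣ ≡ 2 * k + 1
    size = begin
      ∣ D ∣                                               ≡⟨ ∣∣≡count D ⟩
      count (order k) (member D)                          ≡⟨ ∑<-cong (order k) (cong ⟦_⟧ ∘ sym ∘ member-D) ⟩
      count (order k) (λ x → isNonCanon x ∨ (x ≡ᵇ 0))     ≡⟨ count-∨-point {order k} isNonCanon (s≤s z≤n) refl ⟩
      suc (count (order k) isNonCanon)                    ≡⟨ cong suc (count-nonCanonical k) ⟩
      suc (2 * k)                                         ≡⟨ +-comm 1 _ ⟩
      2 * k + 1                                           ∎
      where open ≡-Reasoning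

  core-IDS-without-deg-2 : IsIDS G (notDeg2 G) (coreSet p k)
  core-IDS-without-deg-2 =
    fromIsIDSᵇ (sym ∘ member-by-deg (λ d → not (d ≡ᵇ 2))) (sym ∘ member-tabulate (order k) isCore) (core-IDS root-attached k≥1)

  ∣deg1Set∣≤1 : ∣ deg1Set G ∣ ≤ 1
  ∣deg1Set∣≤1 = ≤-trans (≤-reflexive (∣by-deg∣ (_≡ᵇ 1))) count-degree-1≤1

  deg-2-vertices-nonadjacent : ∀ u v → adj G u v ≡ true → deg G u ≡ 2 → deg G v ≡ 2 → ⊥
  deg-2-vertices-nonadjacent u v uv du dv =
    no-adjacent-degree-2 (from T-≡ uv) (trans (sym (deg≡degree u)) du) (trans (sym (deg≡degree v)) dv)

  Deletable : Fin (order k) → Set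
  Deletable v = v ≡ root p k ⊎ deg G v ≡ 2

  deletable-canonical : ∀ {v} → Deletable v → T (isCanon (toℕ v))
  deletable-canonical (inj₁ refl) = _
  deletable-canonical {v} (inj₂ d≡2) = degree≤2⇒canonical (toℕ<n v) (≤-reflexive (trans (sym (deg≡degree v)) d≡2))

  2k≤∣IDS-deletion∣ : ∀ {v D} → T (isCanon (toℕ v)) → IsIDS G (⊤ ─ ⁅ v ⁆) D → 2 * k ≤ ∣ D ∣
  2k≤∣IDS-deletion∣ {v} {D} canon ids = subst (_≤ ∣ D ∣) (count-canonical-except k (toℕ<n v) canon)
    (lower-bound-on (λ x → not (x ≡ᵇ toℕ v)) (member-⊤─⁅⁆ v) nonCanonical-kept ids)
    where
    nonCanonical-kept : ∀ {x} → x < order k → ¬ T (isCanon x) → T (not (x ≡ᵇ toℕ v))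
    nonCanonical-kept {x} _ ¬canon with x ≟ toℕ v
    ... | yes refl = ⊥-elim (¬canon canon)
    ... | no x≢v = subst (T ∘ not) (sym (≢⇒≡ᵇ-false x≢v)) _

  deletion-witness : ∀ {v} → Deletable v → Σ (Subset (order k)) λ D → IsIDS G (⊤ ─ ⁅ v ⁆) D × ∣ D ∣ ≡ 2 * k
  deletion-witness {v} deletable with toℕ v ≟ 0
  ... | yes v≡0 = toSet (order k) isNonCanon ,
                  fromIsIDSᵇ S≗ (sym ∘ member-tabulate (order k) isNonCanon) nonCanonical-IDS ,
                  trans (∣tabulate∣ (order k) isNonCanon) (count-nonCanonical k)
    where
    S≗ : ∀ {x} → x < order k → not (x ≡ᵇ 0) ≡ member (⊤ ─ ⁅ v ⁆) x
    S≗ {x} x<N = sym (trans (member-⊤─⁅⁆ v x<N) (cong (λ z → not (x ≡ᵇ z)) v≡0))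
  ... | no v≢0 = toSet (order k) D′ ,
                 fromIsIDSᵇ (sym ∘ member-⊤─⁅⁆ v) (sym ∘ member-tabulate (order k) D′) (canonical-except-IDS unattached) ,
                 trans (∣tabulate∣ (order k) D′) (count-canonical-except k (toℕ<n v) (deletable-canonical deletable))
    where
    D′ : ℕ → Bool
    D′ x = isCanon x ∧ not (x ≡ᵇ toℕ v)
    degree-2 : Deletable v → degree k (toℕ v) ≡ 2
    degree-2 (inj₁ refl) = ⊥-elim (v≢0 refl)
    degree-2 (inj₂ d≡2) = trans (sym (deg≡degree v)) d≡2
    unattached : ∀ {j} → j < k → p j ≢ toℕ v
    unattached = degree≡2⇒unattached (toℕ<n v) v≢0 (degree-2 deletable)

  deletion : ∀ v → Deletable v → ∀ m → IsIndDomNum G ⊤ m → IsIndDomNum G (⊤ ─ ⁅ v ⁆) (m ∸ 1)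
  deletion v deletable m i≡m with deletion-witness deletable
  ... | D , ids , size = subst (IsIndDomNum G (⊤ ─ ⁅ v ⁆)) (sym m∸1≡2k)
                               (D , minimum ids size (2k≤∣IDS-deletion∣ (deletable-canonical deletable)) , size)
    where
    m∸1≡2k : m ∸ 1 ≡ 2 * k
    m∸1≡2k = trans (cong (_∸ 1) (i≡m⇒m≡2k+1 i≡m)) (m+n∸n≡m (2 * k) 1)

proposition1 : (k : ℕ) → 1 ≤ k → (p : ℕ → ℕ) → ValidSeq p k →
    (IsIndDomNum (B p k) ⊤ (2 * k + 1)
      × weight (B p k) ≡ 16 * k + 6
      × (∀ m → IsIndDomNum (B p k) ⊤ m → 8 * m ≡ weight (B p k) + 2))
    × IsMinIDS (B p k) ⊤ (canonicalSet p k)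
    × IsMinIDS (B p k) ⊤ (nonCanonicalSet p k ∪ ⁅ root p k ⁆)
    × (∀ (v : Fin (n (B p k))) → (v ≡ root p k ⊎ deg (B p k) v ≡ 2) →
         ∀ m → IsIndDomNum (B p k) ⊤ m → IsIndDomNum (B p k) (⊤ ─ ⁅ v ⁆) (m ∸ 1))
    × IsIDS (B p k) (notDeg2 (B p k)) (coreSet p k)
    × (∣ deg1Set (B p k) ∣ ≤ 1
      × (∀ (u v : Fin (n (B p k))) → adj (B p k) u v ≡ true →
           deg (B p k) u ≡ 2 → deg (B p k) v ≡ 2 → ⊥))
proposition1 k k≥1 p valid =
  (i≡2k+1 , weight-G , 8i≡w+2) ,
  canonical-minimum ,
  nonCanonical-root-minimum ,
  deletion ,
  core-IDS-without-deg-2 ,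
  (∣deg1Set∣≤1 , deg-2-vertices-nonadjacent)
  where open ValidSequence p k k≥1 valid
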